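{- Let $p$ be an odd prime and let $c\in GF(p)\setminus\{0\}$ be a nonsquare if $p\equiv 1 \pmod 4$ and a nonzero square if $p\equiv 3\pmod 4$. For $k\in\{1,\dots,p-1\}$ let $O_k\subset PG(2,p)$ be the conic $x^2+ky^2+ckz^2=0$. Then for every $\beta\in\{1,\dots,p-1\}$ there are exactly $\frac{p-1}{2}$ indices $\alpha\in\{1,\dots,p-1\}$ such that $O_\alpha\diamond O_\beta$.
   Context: $PG(2,p)$ is the projective plane over $GF(p)$ with homogeneous coordinates. A point $P$ is an exterior point of a conic $O$ if exactly two tangents of $O$ (lines meeting $O$ in exactly one point) pass through $P$. For conics $O,O'$, $O\diamond O'$ means every point of $O'$ is an exterior point of $O$. -}

module Defs where

open import Data.Nat using (ℕ; zero; suc; _+_; _*_; _∸_; _%_; _≡ᵇ_)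
open import Data.Bool using (Bool; true; false; _∧_; if_then_else_)
open import Data.List using (List; []; _∷_; map; upTo; concatMap; length; filterᵇ; _++_)
open import Data.Product using (_×_; _,_)
open import Relation.Binary.PropositionalEquality using (_≡_)

-- Elements of GF(p) are represented by naturals 0..p-1; arithmetic is done in ℕ and reduced mod p.
-- A point (or line) of PG(2,p) is represented by its unique normalised homogeneous coordinate
-- triple: a nonzero triple whose first nonzero coordinate equals 1.
Triple : Set
Triple = ℕ × ℕ × ℕ

PG2 : ℕ → List Triple
PG2 p = (0 , 0 , 1)
      ∷ (map (λ z → (0 , 1 , z)) (upTo p)
      ++ concatMap (λ y → map (λ z → (1 , y , z)) (upTo p)) (upTo p))

points : ℕ → List Triple
points = PG2

-- lines of PG(2,p): [a:b:d] denotes the line a x + b y + d z = 0 (same normalised representatives)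
lines : ℕ → List Triple
lines = PG2

-- reduction mod p (p is a prime in the theorem, so the zero case never matters)
mod : ℕ → ℕ → ℕ
mod zero    n = n
mod (suc q) n = n % suc q

isZero : ℕ → ℕ → Bool
isZero p n = mod p n ≡ᵇ 0

all : {A : Set} → (A → Bool) → List A → Bool
all f []       = true
all f (x ∷ xs) = f x ∧ all f xs

incident : ℕ → Triple → Triple → Bool
incident p (x , y , z) (a , b , d) = isZero p (a * x + b * y + d * z)

onConic : ℕ → ℕ → ℕ → Triple → Bool
onConic p c k (x , y , z) = isZero p (x * x + k * y * y + c * k * z * z)

count : {A : Set} → (A → Bool) → List A → ℕ
count f xs = length (filterᵇ f xs)

isTangent : ℕ → ℕ → ℕ → Triple → Bool
isTangent p c k L = count (λ P → onConic p c k P ∧ incident p P L) (points p) ≡ᵇ 1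

isExterior : ℕ → ℕ → ℕ → Triple → Bool
isExterior p c k P = count (λ L → incident p P L ∧ isTangent p c k L) (lines p) ≡ᵇ 2

diamond : ℕ → ℕ → ℕ → ℕ → Bool
diamond p c α β = all (λ P → if onConic p c β P then isExterior p c α P else true) (points p)

indices : ℕ → List ℕ
indices p = map suc (upTo (p ∸ 1))

IsSquare : ℕ → ℕ → Set
IsSquare p c = Data.Product.∃ λ t → mod p (t * t) ≡ mod p c

module Submission where

-- For a diagonal conic e = (e₁,e₂,e₃), e₁e₂e₃ ≠ 0, and a line L, the
-- form restricted to L is a binary quadratic form with discriminant -Δ(e,L) up to a nonzero
-- square, Δ(e,L) = e₂e₃a² + e₁e₃b² + e₁e₂d²; so L meets the conic in 0, 1 or 2 points as -Δ
-- is a nonsquare, zero or a nonzero square (BinaryForms, ConicLine).  Hence the tangents of O_k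
-- form the dual conic, and counting its points on the line of a point P shows: P is exterior
-- to O_k iff -c·Q_k(P) is a nonzero square (Tangency).  For P = (x,y,z) on O_β,
-- -c·Q_α(P) = cβ(α-β)·(x/β)² with x ≠ 0, and O_β has a point by pigeonhole, so
-- O_α ◇ O_β iff cβ(α-β) is a nonzero square (DiamondCount).  The hypothesis on c says that -c
-- is a nonsquare, since -1 is a square iff (p-1)/2 is even: inversion is an involution of the
-- (p-1)/2 nonzero squares whose fixed points are 1 and possibly -1 (QuadraticResidues).  Then
-- s ↦ β + s/(cβ) is a bijection from the nonzero squares onto the admissible α, never 0.

open import Defs
open import Data.Nat using (ℕ; _<_; _≤_; _%_; _∸_; _/_)
open import Data.Nat.Primality using (Prime)
open import Data.Product using (_×_)
open import Relation.Nullary using (¬_)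
open import Relation.Binary.PropositionalEquality using (_≡_)
import Data.Nat as ℕ
open import Data.Nat.Primality using (prime⇒nonZero)
open import Data.Empty using (⊥-elim)
import Relation.Binary.PropositionalEquality as Eq


-- The integer operations are made opaque so that the type checker never unfolds them
-- while comparing terms; ring identities are proved inside `unfolding` blocks.
module IntegerOps where

  open import Data.Integer as Z using (ℤ; +_)
  import Data.Integer.Properties as ZP
  open import Data.Nat as ℕ using (ℕ)
  open import Relation.Binary.PropositionalEquality using (_≡_; refl)

  infixl 6 _+_
  infixl 7 _*_
  infix 8 -_
  infixl 6 _-_

  opaque
    _+_ : ℤ → ℤ → ℤ
    _+_ = Z._+_
    _*_ : ℤ → ℤ → ℤ
    _*_ = Z._*_
    -_ : ℤ → ℤ
    -_ = Z.-_

  _-_ : ℤ → ℤ → ℤ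
  a - b = a + (- b)

  opaque
    unfolding _+_ _*_ -_

    pos-+ : ∀ m n → + (m ℕ.+ n) ≡ + m + + n
    pos-+ = ZP.pos-+

    pos-* : ∀ m n → + (m ℕ.* n) ≡ + m * + n
    pos-* = ZP.pos-*

    *-zeroʳ : ∀ a → a * + 0 ≡ + 0
    *-zeroʳ = ZP.*-zeroʳ
    *-zeroˡ : ∀ a → + 0 * a ≡ + 0
    *-zeroˡ = ZP.*-zeroˡ
    *-identityʳ : ∀ a → a * + 1 ≡ a
    *-identityʳ = ZP.*-identityʳ
    *-identityˡ : ∀ a → + 1 * a ≡ a
    *-identityˡ = ZP.*-identityˡ
    +-identityʳ : ∀ a → a + + 0 ≡ a
    +-identityʳ = ZP.+-identityʳ
    +-identityˡ : ∀ a → + 0 + a ≡ a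
    +-identityˡ = ZP.+-identityˡ
    *-comm : ∀ a b → a * b ≡ b * a
    *-comm = ZP.*-comm
    neg-distribˡ-* : ∀ a b → - (a * b) ≡ (- a) * b
    neg-distribˡ-* = ZP.neg-distribˡ-*
    neg0 : - (+ 0) ≡ + 0
    neg0 = refl


module BooleanFacts where

  open import Data.Nat using (zero; suc; _≡ᵇ_)
  import Data.Nat.Properties as ℕP
  open import Data.Bool using (true; false; T; _∧_)
  open import Data.Product using (_×_; _,_)
  open import Data.Empty using (⊥-elim)
  open import Relation.Binary.PropositionalEquality using (_≡_; _≢_; refl; cong)

  ∧-true : ∀ {a b} → a ∧ b ≡ true → (a ≡ true) × (b ≡ true)
  ∧-true {true} {true} _ = refl , refl

  true-∧ : ∀ {a b} → a ≡ true → b ≡ true → a ∧ b ≡ true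
  true-∧ refl refl = refl

  T→≡ : ∀ {b} → T b → b ≡ true
  T→≡ {true} _ = refl

  ≡→T : ∀ {b} → b ≡ true → T b
  ≡→T refl = _

  ≡ᵇ-true : ∀ {m n} → (m ≡ᵇ n) ≡ true → m ≡ n
  ≡ᵇ-true {m} {n} h = ℕP.≡ᵇ⇒≡ m n (≡→T h)

  true-≡ᵇ : ∀ {m n} → m ≡ n → (m ≡ᵇ n) ≡ true
  true-≡ᵇ {m} {n} h = T→≡ (ℕP.≡⇒≡ᵇ m n h)

  ≡ᵇ-false : ∀ {x y} → x ≢ y → (x ≡ᵇ y) ≡ false
  ≡ᵇ-false {zero} {zero} ne = ⊥-elim (ne refl)
  ≡ᵇ-false {zero} {suc y} ne = refl
  ≡ᵇ-false {suc x} {zero} ne = refl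
  ≡ᵇ-false {suc x} {suc y} ne = ≡ᵇ-false (λ e → ne (cong suc e))


module Counting where

  open import Defs
  open BooleanFacts
  open import Data.Nat as ℕ using (ℕ; suc)
  import Data.Nat.Properties as ℕP
  open import Data.Bool using (Bool; true; false)
  open import Data.Bool.Properties using (T?)
  open import Data.List using (List; []; _∷_; _++_; length; map)
  import Data.List.Membership.Propositional.Properties as ∈
  open import Data.List.Membership.Propositional using (_∈_)
  open import Data.List.Relation.Unary.Any using (here; there)
  open import Data.List.Relation.Unary.Unique.Propositional using (Unique)
  import Data.List.Relation.Unary.Unique.Propositional.Properties as UP
  open import Data.List.Relation.Unary.AllPairs as AllPairs using (_∷_; [])
  open import Data.List.Relation.Unary.All as All using (All)
  open import Data.Product using (Σ; _×_; _,_; proj₁; proj₂)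
  open import Data.Empty using (⊥-elim)
  open import Relation.Nullary using (¬_; yes; no)
  open import Function using (_∘_)
  open import Relation.Binary.PropositionalEquality as Eq using (_≡_; _≢_; refl; cong; sym; trans; subst)
  open Eq.≡-Reasoning

  module _ {A : Set} where

    ∈-remove : ∀ {x y : A} (as bs : List A) → y ∈ as ++ x ∷ bs → y ≢ x → y ∈ as ++ bs
    ∈-remove [] bs (here e) ne = ⊥-elim (ne e)
    ∈-remove [] bs (there m) ne = m
    ∈-remove (a ∷ as) bs (here e) ne = here e
    ∈-remove (a ∷ as) bs (there m) ne = there (∈-remove as bs m ne)

    ∈-insert : ∀ {x y : A} (as bs : List A) → y ∈ as ++ bs → y ∈ as ++ x ∷ bs
    ∈-insert [] bs m = there m
    ∈-insert (a ∷ as) bs (here e) = here e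
    ∈-insert (a ∷ as) bs (there m) = there (∈-insert as bs m)

    length-middle : ∀ {x : A} (as bs : List A) → length (as ++ x ∷ bs) ≡ suc (length (as ++ bs))
    length-middle [] bs = refl
    length-middle (a ∷ as) bs = cong suc (length-middle as bs)

    count-middle : ∀ (g : A → Bool) {y : A} (as bs : List A) → g y ≡ false
      → count g (as ++ y ∷ bs) ≡ count g (as ++ bs)
    count-middle g [] bs gy rewrite gy = refl
    count-middle g (a ∷ as) bs gy with g a
    ... | true = cong suc (count-middle g as bs gy)
    ... | false = count-middle g as bs gy

    unique-middle : ∀ {y : A} (as bs : List A) → Unique (as ++ y ∷ bs) → Unique (as ++ bs) × ¬ (y ∈ as ++ bs)
    unique-middle [] bs (a ∷ u) = u , λ m → All.lookup a m refl
    unique-middle (a ∷ as) bs (pa ∷ u) with unique-middle as bs u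
    ... | u' , ny = (All.tabulate (λ m → All.lookup pa (∈-insert as bs m)) ∷ u') ,
                    λ { (here refl) → All.lookup pa (∈.∈-insert as) refl ; (there m) → ny m }

  module _ {A : Set} where

    private
      all≢ : ∀ {x : A} {xs} → All (x ≢_) xs → ∀ {y} → y ∈ xs → y ≢ x
      all≢ (px All.∷ _) (here refl) e = px (sym e)
      all≢ (_ All.∷ a) (there m) e = all≢ a m e

    unique-⊆⇒length-≤ : ∀ {xs ys : List A} → Unique xs → (∀ {z} → z ∈ xs → z ∈ ys) → length xs ℕ.≤ length ys
    unique-⊆⇒length-≤ {[]} u s = ℕ.z≤n
    unique-⊆⇒length-≤ {x ∷ xs} {ys} (a ∷ u) s with ∈.∈-∃++ (s (here refl))
    ... | as , bs , eq = subst (suc (length xs) ℕ.≤_) (sym (trans (cong length eq) (length-middle as bs)))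
         (ℕ.s≤s (unique-⊆⇒length-≤ u (λ {z} m → ∈-remove as bs (subst (z ∈_) eq (s (there m))) (all≢ a m))))

    count≡length : ∀ (f : A → Bool) {xs ys : List A} → Unique xs → Unique ys
      → (∀ z → z ∈ ys → z ∈ xs × f z ≡ true)
      → (∀ z → z ∈ xs → f z ≡ true → z ∈ ys)
      → count f xs ≡ length ys
    count≡length f {xs} {ys} ux uy sound complete = ℕP.≤-antisym
       (unique-⊆⇒length-≤ (UP.filter⁺ (T? ∘ f) ux) λ {z} m →
          let (z∈xs , fz) = ∈.∈-filter⁻ (T? ∘ f) m in complete z z∈xs (T→≡ fz))
       (unique-⊆⇒length-≤ uy λ {z} m →
          let (z∈xs , fz) = sound z m in ∈.∈-filter⁺ (T? ∘ f) z∈xs (≡→T fz))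

    all-sound : ∀ {f : A → Bool} {xs : List A} → all f xs ≡ true → ∀ z → z ∈ xs → f z ≡ true
    all-sound {f} {x ∷ xs} h z m with f x in fx
    all-sound {f} {x ∷ xs} h z (here refl) | true = fx
    all-sound {f} {x ∷ xs} h z (there m)   | true = all-sound {f} {xs} h z m

    all-complete : ∀ (f : A → Bool) (xs : List A) → (∀ z → z ∈ xs → f z ≡ true) → all f xs ≡ true
    all-complete f [] h = refl
    all-complete f (x ∷ xs) h rewrite h x (here refl) = all-complete f xs (λ z m → h z (there m))

  map-unique : ∀ {A B : Set} (f : A → B) {xs : List A} → Unique xs →
    (∀ {x y} → x ∈ xs → y ∈ xs → f x ≡ f y → x ≡ y) → Unique (map f xs)
  map-unique f {[]} u inj = []
  map-unique f {x ∷ xs} (a ∷ u) inj =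
    new a (λ m e → inj (here refl) (there m) e) ∷ map-unique f u (λ m m' e → inj (there m) (there m') e)
    where
    new : ∀ {ys} → All (x ≢_) ys → (∀ {y} → y ∈ ys → f x ≡ f y → x ≡ y) → All (f x ≢_) (map f ys)
    new {[]} All.[] _ = All.[]
    new {y ∷ ys} (px All.∷ a') g = (λ e → px (g (here refl) e)) All.∷ new a' (λ m e → g (there m) e)

  record InvolutionOn (f : ℕ → ℕ) (xs : List ℕ) : Set where
    field
      closed     : ∀ {x} → x ∈ xs → f x ∈ xs
      involutive : ∀ {x} → x ∈ xs → f (f x) ≡ x
  open InvolutionOn

  isFixed : (ℕ → ℕ) → ℕ → Bool
  isFixed f x = f x ℕ.≡ᵇ x

  private
    involution-tail : ∀ {f x rest} → Unique (x ∷ rest) → InvolutionOn f (x ∷ rest) → f x ≡ x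
      → InvolutionOn f rest
    involution-tail {f} {x} {rest} (x∉rest ∷ _) inv fx≡x = record
      { closed = λ m → stay m (closed inv (there m)) ; involutive = λ m → involutive inv (there m) }
      where
      stay : ∀ {y} → y ∈ rest → f y ∈ x ∷ rest → f y ∈ rest
      stay m (there m') = m'
      stay {y} m (here fy≡x) = ⊥-elim (All.lookup x∉rest m (begin
        x         ≡⟨ sym fx≡x ⟩
        f x       ≡⟨ cong f (sym fy≡x) ⟩
        f (f y)   ≡⟨ involutive inv (there m) ⟩
        y         ∎))

    -- Removing a non-fixed head x together with its partner f x.
    record PairRemoved (f : ℕ → ℕ) (x : ℕ) (rest : List ℕ) : Set where
      field
        ys          : List ℕ
        ys-unique   : Unique ys
        ys-inv      : InvolutionOn f ys
        ys-length   : length rest ≡ suc (length ys)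
        ys-count    : count (isFixed f) (x ∷ rest) ≡ count (isFixed f) ys

    remove-pair : ∀ {f x rest} → Unique (x ∷ rest) → InvolutionOn f (x ∷ rest) → f x ≢ x
      → PairRemoved f x rest
    remove-pair {f} {x} {rest} (x∉rest ∷ u) inv fx≢x with closed inv (here refl)
    ... | here fx≡x = ⊥-elim (fx≢x fx≡x)
    ... | there fx∈rest with ∈.∈-∃++ fx∈rest
    ...   | as , bs , eq = record
      { ys = as ++ bs ; ys-unique = proj₁ split ; ys-inv = record { closed = closed' ; involutive = λ m → involutive inv (there (into m)) }
      ; ys-length = trans (cong length eq) (length-middle as bs) ; ys-count = counts }
      where
      split : Unique (as ++ bs) × ¬ (f x ∈ as ++ bs)
      split = unique-middle as bs (subst Unique eq u)
      into : ∀ {y} → y ∈ as ++ bs → y ∈ rest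
      into {y} m = subst (y ∈_) (sym eq) (∈-insert as bs m)
      ffx≡x : f (f x) ≡ x
      ffx≡x = involutive inv (here refl)
      closed' : ∀ {y} → y ∈ as ++ bs → f y ∈ as ++ bs
      closed' {y} m with closed inv (there (into m))
      ... | here fy≡x = ⊥-elim (proj₂ split (subst (_∈ as ++ bs) (trans (sym (involutive inv (there (into m)))) (cong f fy≡x)) m))
      ... | there fy∈rest = ∈-remove as bs (subst (f y ∈_) eq fy∈rest)
             (λ fy≡fx → All.lookup x∉rest (into m) (sym (trans (sym (involutive inv (there (into m)))) (trans (cong f fy≡fx) ffx≡x))))
      counts : count (isFixed f) (x ∷ rest) ≡ count (isFixed f) (as ++ bs)
      counts rewrite ≡ᵇ-false fx≢x = trans (cong (count (isFixed f)) eq)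
        (count-middle (isFixed f) as bs (subst (λ z → (z ℕ.≡ᵇ f x) ≡ false) (sym ffx≡x) (≡ᵇ-false (fx≢x ∘ sym))))

    -- induction on a fuel bound for the length, as removing a pair is not structural
    involution-parity-fuel : ∀ (n : ℕ) (f : ℕ → ℕ) (xs : List ℕ) → length xs ℕ.≤ n → Unique xs → InvolutionOn f xs →
      Σ ℕ λ k → length xs ≡ count (isFixed f) xs ℕ.+ 2 ℕ.* k
    involution-parity-fuel n f [] _ _ _ = 0 , refl
    involution-parity-fuel (suc n) f (x ∷ rest) (ℕ.s≤s len) u inv with f x ℕ.≟ x
    ... | yes fx≡x with involution-parity-fuel n f rest len (AllPairs.tail u) (involution-tail u inv fx≡x)
    ...   | k , e rewrite fx≡x | true-≡ᵇ {x} refl = k , cong suc e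
    involution-parity-fuel (suc n) f (x ∷ rest) (ℕ.s≤s len) u inv | no fx≢x
      with remove-pair u inv fx≢x
    ... | record { ys = ys ; ys-unique = uys ; ys-inv = invys ; ys-length = lys ; ys-count = cys }
      with involution-parity-fuel n f ys (ℕP.≤-trans (ℕP.n≤1+n _) (subst (ℕ._≤ n) lys len)) uys invys
    ...   | k , e = suc k , (begin
      suc (length rest)                            ≡⟨ cong suc lys ⟩
      suc (suc (length ys))                        ≡⟨ cong (suc ∘ suc) e ⟩
      suc (suc (count (isFixed f) ys ℕ.+ 2 ℕ.* k)) ≡⟨ arith (count (isFixed f) ys) k ⟩
      count (isFixed f) ys ℕ.+ 2 ℕ.* suc k         ≡⟨ cong (ℕ._+ 2 ℕ.* suc k) (sym cys) ⟩
      count (isFixed f) (x ∷ rest) ℕ.+ 2 ℕ.* suc k ∎)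
      where
      arith : ∀ c k → suc (suc (c ℕ.+ 2 ℕ.* k)) ≡ c ℕ.+ 2 ℕ.* suc k
      arith c k = sym (trans (cong (c ℕ.+_) (ℕP.*-suc 2 k)) (trans (ℕP.+-suc c (suc (2 ℕ.* k))) (cong suc (ℕP.+-suc c (2 ℕ.* k)))))

  -- An involution of a duplicate-free list has as many fixed points as the list has
  -- entries, modulo 2: the other entries split into pairs {x, f x}.
  involution-parity : ∀ (f : ℕ → ℕ) (xs : List ℕ) → Unique xs → InvolutionOn f xs →
    Σ ℕ λ k → length xs ≡ count (isFixed f) xs ℕ.+ 2 ℕ.* k
  involution-parity f xs = involution-parity-fuel (length xs) f xs ℕP.≤-refl


module OddPrimeArithmetic where

  open import Data.Nat as ℕ using (ℕ; zero; suc; _<_; _≤_; _%_; _/_; _∸_)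
  import Data.Nat.Properties as ℕP
  import Data.Nat.Divisibility as ℕD
  import Data.Nat.DivMod as ℕDM
  open import Data.Nat.Primality using (Prime; prime⇒nonTrivial)
  import Data.Nat.Tactic.RingSolver as NS
  open import Data.Product using (Σ; _,_)
  open import Data.Sum using (_⊎_; inj₁; inj₂)
  open import Data.Empty using (⊥-elim)
  open import Relation.Binary.PropositionalEquality using (_≡_; refl; cong; sym; trans)

  oddPrime≥3 : ∀ q → Prime (suc q) → suc q % 2 ≡ 1 → 3 ≤ suc q
  oddPrime≥3 zero pr _ = ⊥-elim (ℕP.<-irrefl refl (ℕ.nonTrivial⇒n>1 1 ⦃ prime⇒nonTrivial pr ⦄))
  oddPrime≥3 (suc zero) _ ()
  oddPrime≥3 (suc (suc q)) _ _ = ℕ.s≤s (ℕ.s≤s (ℕ.s≤s ℕ.z≤n))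

  odd⇒even-pred : ∀ q → suc q % 2 ≡ 1 → q ≡ 2 ℕ.* (suc q / 2)
  odd⇒even-pred q odd = trans (ℕP.suc-injective (trans (ℕDM.m≡m%n+[m/n]*n (suc q) 2) (cong (ℕ._+ (suc q / 2) ℕ.* 2) odd)))
                             (ℕP.*-comm (suc q / 2) 2)

  half-pred : ∀ q h → q ≡ 2 ℕ.* h → (suc q ∸ 1) / 2 ≡ h
  half-pred q h e = trans (cong (_/ 2) (trans e (ℕP.*-comm 2 h))) (ℕDM.m*n/n≡m h 2)

  odd-mod4 : ∀ n → n % 2 ≡ 1 → (n % 4 ≡ 1) ⊎ (n % 4 ≡ 3)
  odd-mod4 n odd = go (n % 4) refl (ℕDM.m%n<n n 4)
    where
    odd' : n % 4 % 2 ≡ 1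
    odd' = trans (ℕDM.m∣n⇒o%n%m≡o%m 2 4 n (ℕD.divides 2 refl)) odd
    go : ∀ r → n % 4 ≡ r → r < 4 → (n % 4 ≡ 1) ⊎ (n % 4 ≡ 3)
    go 0 e _ with trans (sym (cong (_% 2) e)) odd'
    ... | ()
    go 1 e _ = inj₁ e
    go 2 e _ with trans (sym (cong (_% 2) e)) odd'
    ... | ()
    go 3 e _ = inj₂ e
    go (suc (suc (suc (suc r)))) e (ℕ.s≤s (ℕ.s≤s (ℕ.s≤s (ℕ.s≤s ()))))

  private
    4k≡2[2k] : ∀ k → k ℕ.* 4 ≡ 2 ℕ.* (2 ℕ.* k)
    4k≡2[2k] = NS.solve-∀
    2+4k≡2[2k+1] : ∀ k → 2 ℕ.+ k ℕ.* 4 ≡ 2 ℕ.* suc (2 ℕ.* k)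
    2+4k≡2[2k+1] = NS.solve-∀

  1mod4⇒half-even : ∀ q h → q ≡ 2 ℕ.* h → suc q % 4 ≡ 1 → Σ ℕ λ m → h ≡ 2 ℕ.* m
  1mod4⇒half-even q h qh e = k , ℕP.*-cancelˡ-≡ h (2 ℕ.* k) 2 (trans (sym qh) (trans q≡ (4k≡2[2k] k)))
    where
    k : ℕ
    k = suc q / 4
    q≡ : q ≡ k ℕ.* 4
    q≡ = ℕP.suc-injective (trans (ℕDM.m≡m%n+[m/n]*n (suc q) 4) (cong (ℕ._+ k ℕ.* 4) e))

  3mod4⇒half-odd : ∀ q h → q ≡ 2 ℕ.* h → suc q % 4 ≡ 3 → Σ ℕ λ m → h ≡ suc (2 ℕ.* m)
  3mod4⇒half-odd q h qh e = k , ℕP.*-cancelˡ-≡ h (suc (2 ℕ.* k)) 2 (trans (sym qh) (trans q≡ (2+4k≡2[2k+1] k)))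
    where
    k : ℕ
    k = suc q / 4
    q≡ : q ≡ 2 ℕ.+ k ℕ.* 4
    q≡ = ℕP.suc-injective (trans (ℕDM.m≡m%n+[m/n]*n (suc q) 4) (cong (ℕ._+ k ℕ.* 4) e))


module PrimeField (q : ℕ) (pr : Prime (ℕ.suc q)) (p≥3 : 3 ≤ ℕ.suc q) where

  open import Data.Nat as ℕ using (ℕ; zero; suc; NonZero)
  import Data.Nat.Properties as ℕP
  import Data.Nat.Divisibility as ℕD
  open import Data.Nat.Primality using (Prime; euclidsLemma)
  open import Data.Nat.Coprimality using (prime⇒coprime; coprime-Bézout)
  import Data.Nat.GCD as GCD
  open import Data.Integer as ℤ using (ℤ; +_; ∣_∣)
  open IntegerOps
  import Data.Integer.Properties as ℤP
  open import Data.Integer.Divisibility.Signed as SD using (divides)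
  import Data.Integer.DivMod as ℤDM
  import Data.Nat.DivMod as ℕDM
  open import Defs using (IsSquare)
  import Data.Integer.Tactic.RingSolver as ZS
  open import Data.Product using (Σ; _×_; _,_; proj₁; proj₂)
  open import Data.Sum using (_⊎_; inj₁; inj₂)
  open import Data.Empty using (⊥; ⊥-elim)
  open import Relation.Nullary using (¬_; Dec; yes; no)
  open import Relation.Binary.PropositionalEquality as Eq using (_≡_; refl; cong)
  open import Relation.Binary.Bundles using (Setoid)
  import Relation.Binary
  import Relation.Binary.Reasoning.Setoid
  import Data.List.Relation.Unary.Any as Any
  import Data.List.Membership.Propositional.Properties as ∈
  import Data.List.Membership.Propositional as ∈M
  open import Data.List using (List; upTo)

  p : ℕ
  p = suc q

  P : ℤ
  P = + p

  infix 4 _≈_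
  record _≈_ (a b : ℤ) : Set where
    constructor mk≈
    field un≈ : P SD.∣ (a - b)
  open _≈_ public

  0ℤ 1ℤ : ℤ
  0ℤ = + 0
  1ℤ = + 1

  opaque
    unfolding _+_ _*_ -_
    private
      l-refl : ∀ a → a - a ≡ + 0 ℤ.* a
      l-refl = ZS.solve-∀
      l-sym : ∀ a b → b - a ≡ - (a - b)
      l-sym = ZS.solve-∀
      l-trans : ∀ a b c → a - c ≡ (a - b) + (b - c)
      l-trans = ZS.solve-∀
      l-+ : ∀ a b c d → (a + c) - (b + d) ≡ (a - b) + (c - d)
      l-+ = ZS.solve-∀
      l-* : ∀ a b c d → (a * c) - (b * d) ≡ c * (a - b) + b * (c - d)
      l-* = ZS.solve-∀
      l-neg : ∀ a b → (- a) - (- b) ≡ - (a - b)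
      l-neg = ZS.solve-∀

    ≈-refl : ∀ {a} → a ≈ a
    ≈-refl {a} = mk≈ (Eq.subst (P SD.∣_) (Eq.sym (l-refl a)) (SD.∣n⇒∣m*n (+ 0) (SD.∣-refl {P})))

    ≡→≈ : ∀ {a b} → a ≡ b → a ≈ b
    ≡→≈ refl = ≈-refl

    ≈-sym : ∀ {a b} → a ≈ b → b ≈ a
    ≈-sym {a} {b} (mk≈ h) = mk≈ (Eq.subst (P SD.∣_) (Eq.sym (l-sym a b)) (SD.∣m⇒∣-m h))

    ≈-trans : ∀ {a b c} → a ≈ b → b ≈ c → a ≈ c
    ≈-trans {a} {b} {c} (mk≈ h1) (mk≈ h2) = mk≈ (Eq.subst (P SD.∣_) (Eq.sym (l-trans a b c)) (SD.∣m∣n⇒∣m+n h1 h2))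

    +-cong : ∀ {a b c d} → a ≈ b → c ≈ d → a + c ≈ b + d
    +-cong {a} {b} {c} {d} (mk≈ h1) (mk≈ h2) = mk≈ (Eq.subst (P SD.∣_) (Eq.sym (l-+ a b c d)) (SD.∣m∣n⇒∣m+n h1 h2))

    *-cong : ∀ {a b c d} → a ≈ b → c ≈ d → a * c ≈ b * d
    *-cong {a} {b} {c} {d} (mk≈ h1) (mk≈ h2) = mk≈ (Eq.subst (P SD.∣_) (Eq.sym (l-* a b c d))
      (SD.∣m∣n⇒∣m+n (SD.∣n⇒∣m*n c h1) (SD.∣n⇒∣m*n b h2)))

    neg-cong : ∀ {a b} → a ≈ b → - a ≈ - b
    neg-cong {a} {b} (mk≈ h) = mk≈ (Eq.subst (P SD.∣_) (Eq.sym (l-neg a b)) (SD.∣m⇒∣-m h))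

    *-congˡ : ∀ {a b} c → a ≈ b → c * a ≈ c * b
    *-congˡ c h = *-cong (≈-refl {c}) h

    *-congʳ : ∀ {a b} c → a ≈ b → a * c ≈ b * c
    *-congʳ c h = *-cong h (≈-refl {c})

    +-congˡ : ∀ {a b} c → a ≈ b → c + a ≈ c + b
    +-congˡ c h = +-cong (≈-refl {c}) h

    +-congʳ : ∀ {a b} c → a ≈ b → a + c ≈ b + c
    +-congʳ c h = +-cong h (≈-refl {c})

    P≈0 : P ≈ 0ℤ
    P≈0 = mk≈ (divides (+ 1) (Eq.trans (ℤP.+-identityʳ P) (Eq.sym (ℤP.*-identityˡ P))))

    *P≈0 : ∀ a → a * P ≈ 0ℤ
    *P≈0 a = mk≈ (Eq.subst (P SD.∣_) (Eq.sym (ℤP.+-identityʳ (a * P))) (SD.∣n⇒∣m*n a (SD.∣-refl {P})))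

    ∣a-0 : ∀ a → a - 0ℤ ≡ a
    ∣a-0 a = ℤP.+-identityʳ a

    ≈0→ℕ∣ : ∀ {a} → a ≈ 0ℤ → p ℕD.∣ ∣ a ∣
    ≈0→ℕ∣ {a} (mk≈ h) = Eq.subst (λ z → p ℕD.∣ ∣ z ∣) (∣a-0 a) (SD.∣⇒∣ᵤ h)

    ℕ∣→≈0 : ∀ {a} → p ℕD.∣ ∣ a ∣ → a ≈ 0ℤ
    ℕ∣→≈0 {a} h = mk≈ (SD.∣ᵤ⇒∣ (Eq.subst (λ z → p ℕD.∣ ∣ z ∣) (Eq.sym (∣a-0 a)) h))

    ≈0? : ∀ a → Dec (a ≈ 0ℤ)
    ≈0? a with p ℕD.∣? ∣ a ∣
    ... | yes h = yes (ℕ∣→≈0 h)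
    ... | no h = no (λ z → h (≈0→ℕ∣ z))

    ≈? : ∀ a b → Dec (a ≈ b)
    ≈? a b with ≈0? (a - b)
    ... | yes (mk≈ h) = yes (mk≈ (Eq.subst (P SD.∣_) (ℤP.+-identityʳ (a - b)) h))
    ... | no h = no (λ { (mk≈ z) → h (mk≈ (Eq.subst (P SD.∣_) (Eq.sym (ℤP.+-identityʳ (a - b))) z)) })

    ≈0→≈ : ∀ {a b} → a - b ≈ 0ℤ → a ≈ b
    ≈0→≈ {a} {b} (mk≈ h) = mk≈ (Eq.subst (P SD.∣_) (ℤP.+-identityʳ (a - b)) h)

    ≈→≈0 : ∀ {a b} → a ≈ b → a - b ≈ 0ℤ
    ≈→≈0 {a} {b} (mk≈ h) = mk≈ (Eq.subst (P SD.∣_) (Eq.sym (ℤP.+-identityʳ (a - b))) h)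

    domain : ∀ a b → a * b ≈ 0ℤ → a ≈ 0ℤ ⊎ b ≈ 0ℤ
    domain a b h with euclidsLemma ∣ a ∣ ∣ b ∣ pr (Eq.subst (p ℕD.∣_) (ℤP.abs-* a b) (≈0→ℕ∣ h))
    ... | inj₁ x = inj₁ (ℕ∣→≈0 x)
    ... | inj₂ y = inj₂ (ℕ∣→≈0 y)

    instance
      P-nz : ℤ.NonZero P
      P-nz = _

    canon : ℤ → ℕ
    canon a = a ℤDM.% P

    canon< : ∀ a → canon a ℕ.< p
    canon< a = ℤDM.n%d<d a P

    canon≈ : ∀ a → + canon a ≈ a
    canon≈ a = ≈-sym (Eq.subst (λ z → z ≈ + canon a) (Eq.sym (ℤDM.a≡a%n+[a/n]*n a P))
      (≈-trans (+-congˡ (+ canon a) (*P≈0 (a ℤDM./ P))) (≡→≈ (ℤP.+-identityʳ _))))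

    canon-injective : ∀ {a b} → canon a ≡ canon b → a ≈ b
    canon-injective e = ≈-trans (≈-sym (canon≈ _)) (≈-trans (≡→≈ (cong +_ e)) (canon≈ _))

    private
      residues-distinct : ∀ {m n} → m ℕ.< n → n ℕ.< p → + n ≈ + m → ⊥
      residues-distinct {m} {n} m<n n<p (mk≈ h') = ℕP.<-irrefl refl (ℕP.≤-<-trans (ℕP.≤-trans (ℕD.∣⇒≤ ⦃ nz ⦄ dv) (ℕP.m∸n≤m n m)) n<p)
        where
        eqd : ∣ + n - + m ∣ ≡ n ℕ.∸ m
        eqd = Eq.trans (cong ∣_∣ (ℤP.[+m]-[+n]≡m⊖n n m)) (Eq.trans (ℤP.∣m⊖n∣≡∣n⊖m∣ n m) (ℤP.∣⊖∣-< m<n))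
        nz : NonZero (n ℕ.∸ m)
        nz = ℕ.>-nonZero (ℕP.m<n⇒0<n∸m m<n)
        dv : p ℕD.∣ (n ℕ.∸ m)
        dv = Eq.subst (p ℕD.∣_) eqd (SD.∣⇒∣ᵤ h')

    residue-unique : ∀ {m n} → m ℕ.< p → n ℕ.< p → + m ≈ + n → m ≡ n
    residue-unique {m} {n} m< n< h with ℕP.<-cmp m n
    ... | Relation.Binary.tri≈ _ e _ = e
    ... | Relation.Binary.tri< m<n _ _ = ⊥-elim (residues-distinct m<n n< (≈-sym h))
    ... | Relation.Binary.tri> _ _ n<m = ⊥-elim (residues-distinct n<m m< h)

  ≈-setoid : Setoid _ _
  ≈-setoid = record { Carrier = ℤ ; _≈_ = _≈_ ;
    isEquivalence = record { refl = ≈-refl ; sym = ≈-sym ; trans = ≈-trans } }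

  ≉0 : ℤ → Set
  ≉0 a = ¬ (a ≈ 0ℤ)

  private
    no31 : ¬ (3 ℕ.≤ 1)
    no31 (ℕ.s≤s ())
    no32 : ¬ (3 ℕ.≤ 2)
    no32 (ℕ.s≤s (ℕ.s≤s ()))

  1≉0 : ≉0 1ℤ
  1≉0 h = no31 (ℕP.≤-trans p≥3 (ℕD.∣⇒≤ (≈0→ℕ∣ h)))

  2≉0 : ≉0 (+ 2)
  2≉0 h = no32 (ℕP.≤-trans p≥3 (ℕD.∣⇒≤ (≈0→ℕ∣ h)))
  mul≉0 : ∀ {a b} → ≉0 a → ≉0 b → ≉0 (a * b)
  mul≉0 {a} {b} ha hb h with domain a b h
  ... | inj₁ x = ha x
  ... | inj₂ y = hb y

  ≉0-resp : ∀ {a b} → a ≈ b → ≉0 a → ≉0 b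
  ≉0-resp e h z = h (≈-trans e z)

  opaque
    unfolding _+_ _*_ -_
    l-canc : ∀ a x y → a * x - a * y ≡ a * (x - y)
    l-canc = ZS.solve-∀

  cancelˡ : ∀ {a x y} → ≉0 a → a * x ≈ a * y → x ≈ y
  cancelˡ {a} {x} {y} ha h with domain a (x - y) (Eq.subst (λ z → z ≈ 0ℤ) (l-canc a x y) (≈→≈0 h))
  ... | inj₁ z = ⊥-elim (ha z)
  ... | inj₂ z = ≈0→≈ z

  opaque
    unfolding _+_ _*_ -_
    canon≢0 : ∀ {a} → ≉0 a → NonZero (canon a)
    canon≢0 {a} ha with canon a in eq
    ... | zero = ⊥-elim (ha (Eq.subst (λ z → + z ≈ a → a ≈ 0ℤ) (Eq.sym eq) (λ e → ≈-sym e) (canon≈ a)))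
    ... | suc _ = _

    l-inv1 : ∀ y n → n * (- y) - + 1 ≡ - (+ 1 + y * n)
    l-inv1 = ZS.solve-∀
    l-inv2 : ∀ x P → - (x * P) ≡ (- x) * P
    l-inv2 = ZS.solve-∀
    l-inv3 : ∀ y n → n * y - + 1 ≡ y * n - + 1
    l-inv3 = ZS.solve-∀
    l-inv4 : ∀ x P → (+ 1 + x * P) - + 1 ≡ x * P
    l-inv4 = ZS.solve-∀
    toℤ+* : ∀ a b c → + (a ℕ.+ b ℕ.* c) ≡ + a + + b * + c
    toℤ+* a b c = Eq.trans (ℤP.pos-+ a (b ℕ.* c)) (cong (λ z → + a + z) (ℤP.pos-* b c))

    inv-ex : ∀ {a} → ≉0 a → Σ ℤ λ b → a * b ≈ 1ℤ
    inv-ex {a} ha with coprime-Bézout (prime⇒coprime pr ⦃ canon≢0 ha ⦄ (canon< a))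
    ... | GCD.Bézout.+- x y eq = - (+ y) , ≈-trans (*-congʳ (- (+ y)) (≈-sym (canon≈ a))) (mk≈ (divides (- (+ x)) e))
      where
      e : + canon a * (- (+ y)) - + 1 ≡ (- (+ x)) * P
      e = Eq.trans (l-inv1 (+ y) (+ canon a)) (Eq.trans (cong -_ (Eq.trans (Eq.sym (toℤ+* 1 y (canon a))) (Eq.trans (cong +_ eq) (ℤP.pos-* x p)))) (l-inv2 (+ x) P))
    ... | GCD.Bézout.-+ x y eq = + y , ≈-trans (*-congʳ (+ y) (≈-sym (canon≈ a))) (mk≈ (divides (+ x) e))
      where
      e : + canon a * (+ y) - + 1 ≡ (+ x) * P
      e = Eq.trans (l-inv3 (+ y) (+ canon a)) (Eq.trans (cong (_- + 1) (Eq.trans (Eq.sym (ℤP.pos-* y (canon a))) (Eq.trans (cong +_ (Eq.sym eq)) (toℤ+* 1 x p)))) (l-inv4 (+ x) P))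

    inv : ℤ → ℤ
    inv a with ≈0? a
    ... | yes _ = 0ℤ
    ... | no h = proj₁ (inv-ex h)

    inv-ok : ∀ {a} → ≉0 a → a * inv a ≈ 1ℤ
    inv-ok {a} ha with ≈0? a
    ... | yes z = ⊥-elim (ha z)
    ... | no h = proj₂ (inv-ex h)

  module ≈R = Relation.Binary.Reasoning.Setoid ≈-setoid

  inv≉0 : ∀ {a} → ≉0 a → ≉0 (inv a)
  inv≉0 {a} ha z = 1≉0 (≈-trans (≈-sym (inv-ok ha)) (≈-trans (*-congˡ a z) (≡→≈ (*-zeroʳ a))))

  opaque
    unfolding _+_ _*_ -_
    l-assoc : ∀ a b c → a * (b * c) ≡ (a * b) * c
    l-assoc = ZS.solve-∀
    l-comm : ∀ a b → a * b ≡ b * a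
    l-comm = ZS.solve-∀

  div-intro : ∀ {a x y} → ≉0 a → x * a ≈ y → x ≈ y * inv a
  div-intro {a} {x} {y} ha h = begin
      x ≈⟨ ≡→≈ (Eq.sym (*-identityʳ x)) ⟩
      x * 1ℤ ≈⟨ *-congˡ x (≈-sym (inv-ok ha)) ⟩
      x * (a * inv a) ≈⟨ ≡→≈ (l-assoc x a (inv a)) ⟩
      (x * a) * inv a ≈⟨ *-congʳ (inv a) h ⟩
      y * inv a ∎
    where open ≈R

  inv-cancel : ∀ {a} y → ≉0 a → (y * inv a) * a ≈ y
  inv-cancel {a} y ha = begin
      (y * inv a) * a ≈⟨ ≡→≈ (Eq.trans (Eq.sym (l-assoc y (inv a) a)) (cong (y *_) (l-comm (inv a) a))) ⟩
      y * (a * inv a) ≈⟨ *-congˡ y (inv-ok ha) ⟩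
      y * 1ℤ ≈⟨ ≡→≈ (*-identityʳ y) ⟩
      y ∎
    where open ≈R

  Sq : ℤ → Set
  Sq a = Σ ℤ λ t → t * t ≈ a

  NSq : ℤ → Set
  NSq a = Sq a × ≉0 a

  Sq-resp : ∀ {a b} → a ≈ b → Sq a → Sq b
  Sq-resp e (t , h) = t , ≈-trans h e

  NSq-resp : ∀ {a b} → a ≈ b → NSq a → NSq b
  NSq-resp e (s , n) = Sq-resp e s , ≉0-resp e n

  opaque
    unfolding _+_ _*_ -_
    l-sqmul : ∀ s t → (s * t) * (s * t) ≡ (s * s) * (t * t)
    l-sqmul = ZS.solve-∀

  Sq-* : ∀ {a b} → Sq a → Sq b → Sq (a * b)
  Sq-* (s , hs) (t , ht) = s * t , ≈-trans (≡→≈ (l-sqmul s t)) (*-cong hs ht)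

  NSq-* : ∀ {a b} → NSq a → NSq b → NSq (a * b)
  NSq-* (sa , na) (sb , nb) = Sq-* sa sb , mul≉0 na nb

  sqNSq : ∀ {u} → ≉0 u → NSq (u * u)
  sqNSq {u} hu = (u , ≈-refl) , mul≉0 hu hu

  NSq-scale : ∀ {m u} → NSq m → ≉0 u → NSq (m * (u * u))
  NSq-scale hm hu = NSq-* hm (sqNSq hu)

  NSq-unscale : ∀ {m u} → NSq (m * (u * u)) → ≉0 u → NSq m
  NSq-unscale {m} {u} h hu = NSq-resp e (NSq-* h (sqNSq (inv≉0 hu)))
    where
    open ≈R
    e : (m * (u * u)) * (inv u * inv u) ≈ m
    e = begin
      (m * (u * u)) * (inv u * inv u) ≈⟨ ≡→≈ (lx m u (inv u)) ⟩
      m * ((u * inv u) * (u * inv u)) ≈⟨ *-congˡ m (*-cong (inv-ok hu) (inv-ok hu)) ⟩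
      m * (1ℤ * 1ℤ) ≈⟨ ≡→≈ (ly m) ⟩
      m ∎
      where
      opaque
       unfolding _+_ _*_ -_
       lx : ∀ m u v → (m * (u * u)) * (v * v) ≡ m * ((u * v) * (u * v))
       lx = ZS.solve-∀
       ly : ∀ m → m * (1ℤ * 1ℤ) ≡ m
       ly = ZS.solve-∀

  opaque
    unfolding _+_ _*_ -_
    l-dsq : ∀ a b → (a - b) * (a + b) ≡ a * a - b * b
    l-dsq = ZS.solve-∀
    l-dsq2 : ∀ a b → a + b ≡ a - (- b)
    l-dsq2 = ZS.solve-∀

  sqrt-eq : ∀ {a b} → a * a ≈ b * b → a ≈ b ⊎ a ≈ - b
  sqrt-eq {a} {b} h with domain (a - b) (a + b) (Eq.subst (_≈ 0ℤ) (Eq.sym (l-dsq a b)) (≈→≈0 h))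
  ... | inj₁ z = inj₁ (≈0→≈ z)
  ... | inj₂ z = inj₂ (≈0→≈ (Eq.subst (_≈ 0ℤ) (l-dsq2 a b) z))

  sq≈0 : ∀ {a} → a * a ≈ 0ℤ → a ≈ 0ℤ
  sq≈0 {a} h with domain a a h
  ... | inj₁ z = z
  ... | inj₂ z = z

  Sq? : ∀ a → Dec (Sq a)
  Sq? a with Any.any? (λ t → ≈? (+ t * + t) a) (upTo p)
  ... | yes h with ∈M.find h
  ...    | t , _ , e = yes (+ t , e)
  Sq? a | no h = no (λ { (t , e) → h (Any.map (λ { refl → ≈-trans (*-cong (canon≈ t) (canon≈ t)) e }) (∈.∈-upTo⁺ (canon< t))) })

  opaque
    unfolding _+_ _*_ -_
    l-a3 : ∀ a b c → a * (b * c) ≡ (a * b) * c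
    l-a3 = ZS.solve-∀

  inv-cong : ∀ {a b} → ≉0 a → a ≈ b → inv a ≈ inv b
  inv-cong {a} {b} na e = begin
      inv a ≈⟨ ≡→≈ (Eq.sym (*-identityʳ (inv a))) ⟩
      inv a * 1ℤ ≈⟨ *-congˡ (inv a) (≈-sym (inv-ok nb)) ⟩
      inv a * (b * inv b) ≈⟨ *-congˡ (inv a) (*-congʳ (inv b) (≈-sym e)) ⟩
      inv a * (a * inv b) ≈⟨ ≡→≈ (l-a3 (inv a) a (inv b)) ⟩
      (inv a * a) * inv b ≈⟨ *-congʳ (inv b) (≈-trans (≡→≈ (*-comm (inv a) a)) (inv-ok na)) ⟩
      1ℤ * inv b ≈⟨ ≡→≈ (*-identityˡ (inv b)) ⟩
      inv b ∎
    where
    open ≈R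
    nb : ≉0 b
    nb = ≉0-resp e na

  inv-inv : ∀ {a} → ≉0 a → inv (inv a) ≈ a
  inv-inv {a} na = ≈-sym (begin
      a ≈⟨ ≡→≈ (Eq.sym (*-identityʳ a)) ⟩
      a * 1ℤ ≈⟨ *-congˡ a (≈-sym (inv-ok (inv≉0 na))) ⟩
      a * (inv a * inv (inv a)) ≈⟨ ≡→≈ (l-a3 a (inv a) (inv (inv a))) ⟩
      (a * inv a) * inv (inv a) ≈⟨ *-congʳ (inv (inv a)) (inv-ok na) ⟩
      1ℤ * inv (inv a) ≈⟨ ≡→≈ (*-identityˡ (inv (inv a))) ⟩
      inv (inv a) ∎)
    where open ≈R

  private
    opaque
      unfolding _+_ _*_ -_
      [xi]²≡x²i² : ∀ x i → (x * i) * (x * i) ≡ (x * x) * (i * i)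
      [xi]²≡x²i² = ZS.solve-∀
      d[mm][ii]≡d[mi][mi] : ∀ d m i → d * (m * m) * (i * i) ≡ d * ((m * i) * (m * i))
      d[mm][ii]≡d[mi][mi] = ZS.solve-∀
      d[1*1]≡d : ∀ d → d * (+ 1 * + 1) ≡ d
      d[1*1]≡d = ZS.solve-∀
      u+v-v≡u : ∀ u v → u + v + - v ≡ u
      u+v-v≡u = ZS.solve-∀
      u+v-u≡v : ∀ u v → u + v + - u ≡ v
      u+v-u≡v = ZS.solve-∀
      neg-neg : ∀ d → - (- d) ≡ d
      neg-neg = ZS.solve-∀

  sq-ratio : ∀ {y m z} → y * y ≈ m * (z * z) → ≉0 z → Sq m
  sq-ratio {y} {m} {z} h z≉0 = y * inv z , (begin
      (y * inv z) * (y * inv z)          ≈⟨ ≡→≈ ([xi]²≡x²i² y (inv z)) ⟩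
      (y * y) * (inv z * inv z)          ≈⟨ *-congʳ (inv z * inv z) h ⟩
      m * (z * z) * (inv z * inv z)      ≈⟨ ≡→≈ (d[mm][ii]≡d[mi][mi] m z (inv z)) ⟩
      m * ((z * inv z) * (z * inv z))    ≈⟨ *-congˡ m (*-cong (inv-ok z≉0) (inv-ok z≉0)) ⟩
      m * (1ℤ * 1ℤ)                      ≈⟨ ≡→≈ (d[1*1]≡d m) ⟩
      m                                  ∎)
    where open ≈R

  cancel-≈0 : ∀ {a b} → ≉0 a → a * b ≈ 0ℤ → b ≈ 0ℤ
  cancel-≈0 {a} {b} a≉0 ab≈0 with domain a b ab≈0
  ... | inj₁ a≈0 = ⊥-elim (a≉0 a≈0)
  ... | inj₂ b≈0 = b≈0

  ≈0-mul : ∀ {a b} → a ≈ 0ℤ → a * b ≈ 0ℤ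
  ≈0-mul {a} {b} h = ≈-trans (*-congʳ b h) (≡→≈ (*-zeroˡ b))

  ≈0-mulˡ : ∀ {a b} → b ≈ 0ℤ → a * b ≈ 0ℤ
  ≈0-mulˡ {a} {b} h = ≈-trans (*-congˡ a h) (≡→≈ (*-zeroʳ a))

  cancel-≈0ʳ : ∀ {a b} → ≉0 b → a * b ≈ 0ℤ → a ≈ 0ℤ
  cancel-≈0ʳ {a} {b} b≉0 ab≈0 with domain a b ab≈0
  ... | inj₁ a≈0 = a≈0
  ... | inj₂ b≈0 = ⊥-elim (b≉0 b≈0)

  ≈0-summand : ∀ {u v} → u ≈ 0ℤ → u + v ≈ 0ℤ → v ≈ 0ℤ
  ≈0-summand {u} {v} u≈0 h = ≈-trans (≈-sym (≈-trans (+-congʳ v u≈0) (≡→≈ (+-identityˡ v)))) h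

  neg≈0 : ∀ {a} → - a ≈ 0ℤ → a ≈ 0ℤ
  neg≈0 {a} e = ≈-trans (≡→≈ (Eq.sym (neg-neg a))) (≈-trans (neg-cong e) (≡→≈ neg0))

  neg-of : ∀ {u v} → u + v ≈ 0ℤ → u ≈ - v
  neg-of {u} {v} e = ≈-trans (≡→≈ (Eq.sym (u+v-v≡u u v))) (≈-trans (+-congʳ (- v) e) (≡→≈ (+-identityˡ (- v))))

  neg-ofʳ : ∀ {u v} → u + v ≈ 0ℤ → v ≈ - u
  neg-ofʳ {u} {v} e = ≈-trans (≡→≈ (Eq.sym (u+v-u≡v u v))) (≈-trans (+-congʳ (- u) e) (≡→≈ (+-identityˡ (- u))))

  ℕ≉0 : ∀ {k} → 1 ℕ.≤ k → k ℕ.< p → ≉0 (+ k)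
  ℕ≉0 {suc k} _ k<p h = ℕP.<-irrefl refl (ℕP.<-≤-trans k<p (ℕD.∣⇒≤ (≈0→ℕ∣ h)))

  private
    ≈-mod : ∀ m → + m ≈ + (m ℕ.% p)
    ≈-mod m = ≈-trans (≡→≈ (Eq.trans (cong +_ (ℕDM.m≡m%n+[m/n]*n m p))
                               (Eq.trans (pos-+ (m ℕ.% p) ((m ℕ./ p) ℕ.* p)) (cong (λ z → + (m ℕ.% p) + z) (pos-* (m ℕ./ p) p)))))
                (≈-trans (+-congˡ (+ (m ℕ.% p)) (*P≈0 (+ (m ℕ./ p)))) (≡→≈ (+-identityʳ _)))

    ≈⇒%≡ : ∀ {m n} → + m ≈ + n → m ℕ.% p ≡ n ℕ.% p
    ≈⇒%≡ {m} {n} e = residue-unique (ℕDM.m%n<n m p) (ℕDM.m%n<n n p) (≈-trans (≈-sym (≈-mod m)) (≈-trans e (≈-mod n)))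

    %≡⇒≈ : ∀ {m n} → m ℕ.% p ≡ n ℕ.% p → + m ≈ + n
    %≡⇒≈ {m} {n} e = ≈-trans (≈-mod m) (≈-trans (≡→≈ (cong +_ e)) (≈-sym (≈-mod n)))

  IsSquare⇒Sq : ∀ c → IsSquare p c → Sq (+ c)
  IsSquare⇒Sq c (t , e) = + t , ≈-trans (≡→≈ (Eq.sym (pos-* t t))) (%≡⇒≈ e)

  Sq⇒IsSquare : ∀ c → Sq (+ c) → IsSquare p c
  Sq⇒IsSquare c (t , e) = canon t , ≈⇒%≡ (≈-trans (≡→≈ (pos-* (canon t) (canon t))) (≈-trans (*-cong (canon≈ t) (canon≈ t)) e))

  private
    opaque
      unfolding _+_ _*_ -_
      [-1][-c]≡c : ∀ c → (- + 1) * (- c) ≡ c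
      [-1][-c]≡c = ZS.solve-∀
      sq-*-sq : ∀ s t → (s * s) * (t * t) ≡ (s * t) * (s * t)
      sq-*-sq = ZS.solve-∀
      [-u²]i² : ∀ u i → (- (u * u)) * (i * i) ≡ - ((u * i) * (u * i))
      [-u²]i² = ZS.solve-∀
      -[1*1] : - (+ 1 * + 1) ≡ - (+ 1)
      -[1*1] = ZS.solve-∀

  neg-nonsquare₁ : ∀ c → Sq (- 1ℤ) → ¬ Sq (+ c) → ¬ Sq (- (+ c))
  neg-nonsquare₁ c (s , es) ns (t , et) =
    ns (s * t , ≈-trans (≡→≈ (Eq.sym (sq-*-sq s t))) (≈-trans (*-cong es et) (≡→≈ ([-1][-c]≡c (+ c)))))

  neg-nonsquare₃ : ∀ c → ¬ Sq (- 1ℤ) → Sq (+ c) → ≉0 (+ c) → ¬ Sq (- (+ c))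
  neg-nonsquare₃ c n1 (u , eu) nc (t , et) = n1 (t * inv u , (begin
      (t * inv u) * (t * inv u)     ≈⟨ ≡→≈ (Eq.sym (sq-*-sq t (inv u))) ⟩
      (t * t) * (inv u * inv u)     ≈⟨ *-congʳ (inv u * inv u) (≈-trans et (neg-cong (≈-sym eu))) ⟩
      (- (u * u)) * (inv u * inv u) ≈⟨ ≡→≈ ([-u²]i² u (inv u)) ⟩
      - ((u * inv u) * (u * inv u)) ≈⟨ neg-cong (*-cong (inv-ok nu) (inv-ok nu)) ⟩
      - (1ℤ * 1ℤ)                   ≈⟨ ≡→≈ -[1*1] ⟩
      - 1ℤ                          ∎))
    where
    open ≈R
    nu : ≉0 u
    nu z = nc (≈-trans (≈-sym eu) (≈-trans (*-congʳ u z) (≡→≈ (*-zeroˡ u))))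


module ProjectivePlane (q : ℕ) (pr : Prime (ℕ.suc q)) (p≥3 : 3 ≤ ℕ.suc q) where

  open import Defs
  open import Data.Nat as ℕ using (ℕ; zero; suc)
  open import Data.Nat.Primality using (Prime)
  open import Data.Integer as ℤ using (ℤ; +_)
  open IntegerOps
  import Data.Integer.Tactic.RingSolver as ZS
  open import Data.List using (List; []; _∷_; _++_; map; upTo; concatMap)
  open import Data.List.Membership.Propositional using (_∈_)
  import Data.List.Membership.Propositional as ∈M
  import Data.List.Membership.Propositional.Properties as ∈
  open import Data.List.Relation.Unary.Any as Any using (here; there)
  open import Data.List.Relation.Unary.Unique.Propositional using (Unique)
  import Data.List.Relation.Unary.Unique.Propositional.Properties as UP
  open import Data.List.Relation.Unary.AllPairs using (_∷_; [])
  open import Data.List.Relation.Unary.All as All using (All)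
  open import Data.Product using (Σ; _×_; _,_; proj₁; proj₂)
  open import Data.Sum using (inj₁; inj₂)
  open import Data.Empty using (⊥; ⊥-elim)
  open import Relation.Nullary using (¬_; yes; no)
  open import Relation.Binary.PropositionalEquality as Eq using (_≡_; refl; cong; cong₂)

  open PrimeField q pr p≥3 public

  data Norm : Triple → Set where
    n001 : Norm (0 , 0 , 1)
    n01z : ∀ {z} → z ℕ.< p → Norm (0 , 1 , z)
    n1yz : ∀ {y z} → y ℕ.< p → z ℕ.< p → Norm (1 , y , z)

  T3 : Set
  T3 = ℤ × ℤ × ℤ

  ι : Triple → T3
  ι (x , y , z) = (+ x , + y , + z)

  c1 c2 c3 : T3 → ℤ
  c1 v = proj₁ v
  c2 v = proj₁ (proj₂ v)
  c3 v = proj₂ (proj₂ v)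

  Comp3 : T3 → T3 → Set
  Comp3 v w = (c1 v ≈ c1 w) × (c2 v ≈ c2 w) × (c3 v ≈ c3 w)

  infix 4 _≈₃_
  record _≈₃_ (v w : T3) : Set where
    constructor ≈₃c
    field get3 : Comp3 v w

  ≈₃-refl : ∀ {v} → v ≈₃ v
  ≈₃-refl = ≈₃c (≈-refl , ≈-refl , ≈-refl)

  ≈₃-sym : ∀ {v w} → v ≈₃ w → w ≈₃ v
  ≈₃-sym (≈₃c (a , b , c)) = ≈₃c (≈-sym a , ≈-sym b , ≈-sym c)

  ≈₃-trans : ∀ {u v w} → u ≈₃ v → v ≈₃ w → u ≈₃ w
  ≈₃-trans (≈₃c (a , b , c)) (≈₃c (a' , b' , c')) = ≈₃c (≈-trans a a' , ≈-trans b b' , ≈-trans c c')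

  scale : ℤ → T3 → T3
  scale t v = (t * c1 v , t * c2 v , t * c3 v)

  scale-cong : ∀ t t' {v w} → t ≈ t' → v ≈₃ w → scale t v ≈₃ scale t' w
  scale-cong _ _ e (≈₃c (a , b , c)) = ≈₃c (*-cong e a , *-cong e b , *-cong e c)

  private
    opaque
     unfolding _+_ _*_ -_
     l-sc : ∀ s t a → s * (t * a) ≡ (s * t) * a
     l-sc = ZS.solve-∀

  scale-scale : ∀ s t v → scale s (scale t v) ≈₃ scale (s * t) v
  scale-scale s t (a , b , c) = ≈₃c (≡→≈ (l-sc s t a) , ≡→≈ (l-sc s t b) , ≡→≈ (l-sc s t c))

  scale-1 : ∀ v → scale 1ℤ v ≈₃ v
  scale-1 (a , b , c) = ≈₃c (≡→≈ (*-identityˡ a) , ≡→≈ (*-identityˡ b) , ≡→≈ (*-identityˡ c))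

  Zero3 : T3 → Set
  Zero3 v = (c1 v ≈ 0ℤ) × (c2 v ≈ 0ℤ) × (c3 v ≈ 0ℤ)

  NZ : T3 → Set
  NZ v = ¬ Zero3 v

  infix 4 _∼_
  _∼_ : T3 → T3 → Set
  v ∼ w = Σ ℤ λ t → ≉0 t × (v ≈₃ scale t w)

  ∼-sym : ∀ {v w} → v ∼ w → w ∼ v
  ∼-sym {v} {w} (t , nt , e) = inv t , inv≉0 nt ,
    ≈₃-sym (≈₃-trans {scale (inv t) v} {scale (inv t) (scale t w)} (scale-cong (inv t) (inv t) ≈-refl e) (≈₃-trans (scale-scale (inv t) t w)
      (≈₃-trans (scale-cong (inv t * t) 1ℤ (≈-trans (≡→≈ (*-comm (inv t) t)) (inv-ok nt)) ≈₃-refl) (scale-1 w))))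

  ∼-trans : ∀ {u v w} → u ∼ v → v ∼ w → u ∼ w
  ∼-trans {u} {v} {w} (s , ns , e) (t , nt , e') = s * t , mul≉0 ns nt ,
    ≈₃-trans e (≈₃-trans (scale-cong s s ≈-refl e') (scale-scale s t w))

  Norm-NZ : ∀ {X} → Norm X → NZ (ι X)
  Norm-NZ n001 (_ , _ , c) = 1≉0 c
  Norm-NZ (n01z _) (_ , b , _) = 1≉0 b
  Norm-NZ (n1yz _ _) (a , _ , _) = 1≉0 a

  private
    t*0 : ∀ t → t * + 0 ≡ + 0
    t*0 t = *-zeroʳ t
    t*1 : ∀ t → t * + 1 ≡ t
    t*1 t = *-identityʳ t

    no10 : ∀ {t} → 1ℤ ≈ t * + 0 → ⊥
    no10 {t} e = 1≉0 (≈-trans e (≡→≈ (t*0 t)))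
    no01 : ∀ {t} → ≉0 t → + 0 ≈ t * + 1 → ⊥
    no01 {t} nt e = nt (≈-sym (≈-trans e (≡→≈ (t*1 t))))
    t≈1 : ∀ {t} → 1ℤ ≈ t * + 1 → t ≈ 1ℤ
    t≈1 {t} e = ≈-sym (≈-trans e (≡→≈ (t*1 t)))
    eqc : ∀ {t z z'} → z ℕ.< p → z' ℕ.< p → t ≈ 1ℤ → + z ≈ t * + z' → z ≡ z'
    eqc {t} {z} {z'} z< z'< t1 e = residue-unique z< z'< (≈-trans e (≈-trans (*-congʳ (+ z') t1) (≡→≈ (*-identityˡ (+ z')))))

  Norm-uniq : ∀ {X Y} → Norm X → Norm Y → ι X ∼ ι Y → X ≡ Y
  Norm-uniq n001 n001 _ = refl
  Norm-uniq n001 (n01z _) (t , nt , ≈₃c (_ , b , _)) = ⊥-elim (no01 {t} nt b)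
  Norm-uniq n001 (n1yz _ _) (t , nt , ≈₃c (a , _ , _)) = ⊥-elim (no01 {t} nt a)
  Norm-uniq (n01z _) n001 (t , nt , ≈₃c (_ , b , _)) = ⊥-elim (no10 {t} b)
  Norm-uniq (n01z z<) (n01z z'<) (t , nt , ≈₃c (_ , b , c)) = cong (λ w → (0 , 1 , w)) (eqc {t} z< z'< (t≈1 b) c)
  Norm-uniq (n01z _) (n1yz _ _) (t , nt , ≈₃c (a , _ , _)) = ⊥-elim (no01 {t} nt a)
  Norm-uniq (n1yz _ _) n001 (t , nt , ≈₃c (a , _ , _)) = ⊥-elim (no10 {t} a)
  Norm-uniq (n1yz _ _) (n01z _) (t , nt , ≈₃c (a , _ , _)) = ⊥-elim (no10 {t} a)
  Norm-uniq (n1yz y< z<) (n1yz y'< z'<) (t , nt , ≈₃c (a , b , c)) =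
    cong₂ (λ u w → (1 , u , w)) (eqc {t} y< y'< (t≈1 a) b) (eqc {t} z< z'< (t≈1 a) c)

  private
    e-one : ∀ {a} → ≉0 a → 1ℤ ≈ inv a * a
    e-one {a} na = ≈-sym (≈-trans (≡→≈ (*-comm (inv a) a)) (inv-ok na))
    e-can : ∀ a b → + canon (b * inv a) ≈ inv a * b
    e-can a b = ≈-trans (canon≈ (b * inv a)) (≡→≈ (*-comm b (inv a)))
    e-zero : ∀ {a} t → a ≈ 0ℤ → + 0 ≈ t * a
    e-zero {a} t za = ≈-sym (≈-trans (*-congˡ t za) (≡→≈ (*-zeroʳ t)))

  normΣ : (v : T3) → NZ v → Σ Triple λ X → Norm X × (ι X ∼ v)
  normΣ (a , b , c) nz with ≈0? a
  ... | no na = (1 , canon (b * inv a) , canon (c * inv a)) , n1yz (canon< (b * inv a)) (canon< (c * inv a)) ,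
                inv a , inv≉0 na , ≈₃c (e-one na , e-can a b , e-can a c)
  ... | yes za with ≈0? b
  ...   | no nb = (0 , 1 , canon (c * inv b)) , n01z (canon< (c * inv b)) ,
                inv b , inv≉0 nb , ≈₃c (e-zero (inv b) za , e-one nb , e-can b c)
  ...   | yes zb with ≈0? c
  ...     | no nc = (0 , 0 , 1) , n001 , inv c , inv≉0 nc , ≈₃c (e-zero (inv c) za , e-zero (inv c) zb , e-one nc)
  ...     | yes zc = ⊥-elim (nz (za , zb , zc))

  norm : (v : T3) → NZ v → Triple
  norm v nz = proj₁ (normΣ v nz)

  norm-Norm : ∀ v nz → Norm (norm v nz)
  norm-Norm v nz = proj₁ (proj₂ (normΣ v nz))

  norm-∼ : ∀ v nz → ι (norm v nz) ∼ v
  norm-∼ v nz = proj₂ (proj₂ (normΣ v nz))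

  A01 : ℕ → Triple
  A01 z = (0 , 1 , z)
  B1 : ℕ → ℕ → Triple
  B1 y z = (1 , y , z)

  PG2-Norm : ∀ {X} → X ∈ PG2 p → Norm X
  PG2-Norm (here refl) = n001
  PG2-Norm (there m) with ∈.∈-++⁻ (map A01 (upTo p)) m
  ... | inj₁ m1 with ∈.∈-map⁻ A01 m1
  ...   | z , zm , refl = n01z (∈.∈-upTo⁻ zm)
  PG2-Norm (there m) | inj₂ m2 with ∈M.find (∈.∈-concatMap⁻ (λ y → map (B1 y) (upTo p)) {xs = upTo p} m2)
  ... | y , ym , m3 with ∈.∈-map⁻ (B1 y) m3
  ...   | z , zm , refl = n1yz (∈.∈-upTo⁻ ym) (∈.∈-upTo⁻ zm)

  Norm-PG2 : ∀ {X} → Norm X → X ∈ PG2 p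
  Norm-PG2 n001 = here refl
  Norm-PG2 (n01z z<) = there (∈.∈-++⁺ˡ (∈.∈-map⁺ A01 (∈.∈-upTo⁺ z<)))
  Norm-PG2 (n1yz {y} {z} y< z<) = there (∈.∈-++⁺ʳ (map A01 (upTo p))
    (∈.∈-concatMap⁺ (λ y → map (B1 y) (upTo p))
      (Any.map (λ { refl → ∈.∈-map⁺ (B1 y) (∈.∈-upTo⁺ z<) }) (∈.∈-upTo⁺ y<))))

  private
    allfrom : ∀ {A : Set} {x : A} {xs} → (∀ {y} → y ∈ xs → x Eq.≢ y) → All (x Eq.≢_) xs
    allfrom {xs = []} h = All.[]
    allfrom {xs = x ∷ xs} h = h (here refl) All.∷ allfrom (λ m → h (there m))

    uniqB : ∀ (zs : List ℕ) → Unique zs → ∀ ys → Unique ys →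
      Unique (concatMap (λ y → map (B1 y) zs) ys)
    uniqB zs uz [] _ = []
    uniqB zs uz (y ∷ ys) (a ∷ uy) = UP.++⁺ (UP.map⁺ (λ { refl → refl }) uz) (uniqB zs uz ys uy) disj
      where
      disj : ∀ {v} → ¬ (v ∈ map (B1 y) zs × v ∈ concatMap (λ y → map (B1 y) zs) ys)
      disj (m1 , m2) with ∈.∈-map⁻ (B1 y) m1
      ... | z , _ , refl with ∈M.find (∈.∈-concatMap⁻ (λ y → map (B1 y) zs) {xs = ys} m2)
      ...   | y' , ym , m3 with ∈.∈-map⁻ (B1 y') m3
      ...     | z' , _ , refl = All.lookup a ym refl

  private
    inA : ∀ {v} → v ∈ map A01 (upTo p) → Σ ℕ λ z → v ≡ (0 , 1 , z)
    inA m with ∈.∈-map⁻ A01 m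
    ... | z , _ , e = z , e
    inB : ∀ {v} → v ∈ concatMap (λ y → map (B1 y) (upTo p)) (upTo p) → Σ ℕ λ y → Σ ℕ λ z → v ≡ (1 , y , z)
    inB m with ∈M.find (∈.∈-concatMap⁻ (λ y → map (B1 y) (upTo p)) {xs = upTo p} m)
    ... | y , _ , m3 with ∈.∈-map⁻ (B1 y) m3
    ...   | z , _ , e = y , z , e

  PG2-unique : Unique (PG2 p)
  PG2-unique = allfrom h0 ∷ UP.++⁺ (UP.map⁺ (λ { refl → refl }) (UP.upTo⁺ p))
                 (uniqB (upTo p) (UP.upTo⁺ p) (upTo p) (UP.upTo⁺ p)) disj
    where
    h0 : ∀ {y} → y ∈ (map A01 (upTo p) ++ concatMap (λ y → map (B1 y) (upTo p)) (upTo p))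
         → (0 , 0 , 1) Eq.≢ y
    h0 m e with ∈.∈-++⁻ (map A01 (upTo p)) m
    h0 m e | inj₁ m1 with inA m1
    ... | z , refl with e
    ...   | ()
    h0 m e | inj₂ m2 with inB m2
    ... | _ , _ , refl with e
    ...   | ()
    disj : ∀ {v} → ¬ (v ∈ map A01 (upTo p) × v ∈ concatMap (λ y → map (B1 y) (upTo p)) (upTo p))
    disj (m1 , m2) with inA m1 | inB m2
    ... | z , refl | _ , _ , ()


module BinaryForms (q : ℕ) (pr : Prime (ℕ.suc q)) (p≥3 : 3 ≤ ℕ.suc q) where

  open import Data.Nat as ℕ using (ℕ; zero; suc)
  open import Data.Nat.Primality using (Prime)
  open import Data.Integer as ℤ using (ℤ; +_)
  open IntegerOps
  import Data.Integer.Tactic.RingSolver as ZS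
  open import Data.Product using (Σ; _×_; _,_)
  open import Data.Sum using (_⊎_; inj₁; inj₂)
  open import Relation.Nullary using (¬_; yes; no)
  open import Relation.Binary.PropositionalEquality as Eq using (_≡_; sym)

  open PrimeField q pr p≥3

  Z2 : ℤ × ℤ → Set
  Z2 (l , m) = (l ≈ 0ℤ) × (m ≈ 0ℤ)

  NZ2 : ℤ × ℤ → Set
  NZ2 s = ¬ Z2 s

  infix 4 _∝_
  _∝_ : ℤ × ℤ → ℤ × ℤ → Set
  (l , m) ∝ (r1 , r2) = Σ ℤ λ t → (l ≈ t * r1) × (m ≈ t * r2)

  binForm : ℤ → ℤ → ℤ → ℤ × ℤ → ℤ
  binForm A B C (l , m) = A * (l * l) + + 2 * B * (l * m) + C * (m * m)

  det : ℤ × ℤ → ℤ × ℤ → ℤ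
  det (a , b) (c , d) = a * d - b * c

  disc : ℤ → ℤ → ℤ → ℤ
  disc A B C = B * B - A * C

  module _ (A B C : ℤ) where
    Root : ℤ × ℤ → Set
    Root s = binForm A B C s ≈ 0ℤ

  OneRoot : ℤ → ℤ → ℤ → Set
  OneRoot A B C = Σ (ℤ × ℤ) λ r → NZ2 r × Root A B C r × (∀ s → NZ2 s → Root A B C s → s ∝ r)

  TwoRoots : ℤ → ℤ → ℤ → Set
  TwoRoots A B C = Σ (ℤ × ℤ) λ r → Σ (ℤ × ℤ) λ r' → NZ2 r × NZ2 r' × Root A B C r × Root A B C r' × ≉0 (det r r')
    × (∀ s → NZ2 s → Root A B C s → (s ∝ r) ⊎ (s ∝ r'))

  private
    opaque
      unfolding _+_ _*_ -_
      [xm]i≡[mi]x : ∀ x m i → (x * m) * i ≡ (m * i) * x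
      [xm]i≡[mi]x = ZS.solve-∀
      complete-square : ∀ A B C l m → A * (A * (l * l) + + 2 * B * (l * m) + C * (m * m))
                                       ≡ (A * l + B * m) * (A * l + B * m) - (B * B - A * C) * (m * m)
      complete-square = ZS.solve-∀
      lA≡X-Bm : ∀ A B l m → l * A ≡ (A * l + B * m) - B * m
      lA≡X-Bm = ZS.solve-∀
      ym-Bm≡[y-B]m : ∀ y B m → y * m - B * m ≡ (y - B) * m
      ym-Bm≡[y-B]m = ZS.solve-∀
      form-A≡0 : ∀ B C l m → + 0 + + 2 * B * (l * m) + C * (m * m) ≡ m * (+ 2 * B * l + C * m)
      form-A≡0 = ZS.solve-∀
      X-at-[-B,A] : ∀ A B → (A * (- B) + B * A) * (A * (- B) + B * A) ≡ + 0
      X-at-[-B,A] = ZS.solve-∀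
      [0-B]m≡[-B]m : ∀ B m → (+ 0 - B) * m ≡ (- B) * m
      [0-B]m≡[-B]m = ZS.solve-∀
      m[Cm]≡C[mm] : ∀ m C → m * (C * m) ≡ C * (m * m)
      m[Cm]≡C[mm] = ZS.solve-∀
      X-at-[σ-B,A] : ∀ A B σ → (A * (σ - B) + B * A) * (A * (σ - B) + B * A) ≡ (σ * σ) * (A * A)
      X-at-[σ-B,A] = ZS.solve-∀
      X-at-[-σ-B,A] : ∀ A B σ → (A * (- σ - B) + B * A) * (A * (- σ - B) + B * A) ≡ (σ * σ) * (A * A)
      X-at-[-σ-B,A] = ZS.solve-∀
      det-[σ-B,A]-[-σ-B,A] : ∀ A B σ → (σ - B) * A - A * (- σ - B) ≡ + 2 * σ * A
      det-[σ-B,A]-[-σ-B,A] = ZS.solve-∀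
      σ²m²≡[σm]² : ∀ σ m → (σ * σ) * (m * m) ≡ (σ * m) * (σ * m)
      σ²m²≡[σm]² = ZS.solve-∀
      form-at-[-C,2B] : ∀ B C → (+ 2 * B) * (+ 2 * B * (- C) + C * (+ 2 * B)) ≡ + 0
      form-at-[-C,2B] = ZS.solve-∀
      det-[1,0]-[-C,2B] : ∀ B C → + 1 * (+ 2 * B) - + 0 * (- C) ≡ + 2 * B
      det-[1,0]-[-C,2B] = ZS.solve-∀
      l[2B]≡Y-Cm : ∀ B C l m → l * (+ 2 * B) ≡ (+ 2 * B * l + C * m) - C * m
      l[2B]≡Y-Cm = ZS.solve-∀
      0-Cm≡[-C]m : ∀ C m → + 0 - C * m ≡ (- C) * m
      0-Cm≡[-C]m = ZS.solve-∀

    proportional : ∀ {l m x a} → ≉0 a → l * a ≈ x * m → (l , m) ∝ (x , a)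
    proportional {l} {m} {x} {a} na h = m * inv a ,
      ≈-trans (div-intro na h) (≡→≈ ([xm]i≡[mi]x x m (inv a))) ,
      ≈-sym (inv-cancel m na)

    proportional-[1,0] : ∀ {l m} → m ≈ 0ℤ → (l , m) ∝ (1ℤ , 0ℤ)
    proportional-[1,0] {l} {m} h = l , ≡→≈ (sym (*-identityʳ l)) , ≈-trans h (≡→≈ (sym (*-zeroʳ l)))

    completeSquare : ∀ {A B C} l m → A * binForm A B C (l , m) ≈ (A * l + B * m) * (A * l + B * m) - disc A B C * (m * m)
    completeSquare {A} {B} {C} l m = ≡→≈ (complete-square A B C l m)

    root⇒square : ∀ {A B C l m} → Root A B C (l , m) → (A * l + B * m) * (A * l + B * m) ≈ disc A B C * (m * m)
    root⇒square {A} {B} {C} {l} {m} r = ≈0→≈ (≈-trans (≈-sym (completeSquare l m)) (≈0-mulˡ r))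

    square⇒root : ∀ {A B C l m} → ≉0 A → (A * l + B * m) * (A * l + B * m) ≈ disc A B C * (m * m) → Root A B C (l , m)
    square⇒root {A} {B} {C} {l} {m} nA h = cancel-≈0 nA (≈-trans (completeSquare l m) (≈→≈0 h))

    m≉0 : ∀ {A B C l m} → ≉0 A → Root A B C (l , m) → NZ2 (l , m) → ≉0 m
    m≉0 {A} {B} {C} {l} {m} nA r nz m≈0 = nz (cancel-≈0 nA Al≈0 , m≈0)
      where
      X≈0 : A * l + B * m ≈ 0ℤ
      X≈0 = sq≈0 (≈-trans (root⇒square {A} {B} {C} r) (≈0-mulˡ (≈0-mul m≈0)))
      Al≈0 : A * l ≈ 0ℤ
      Al≈0 = ≈-trans (≈-sym (≈-trans (+-congˡ (A * l) (≈0-mulˡ m≈0)) (≡→≈ (+-identityʳ (A * l))))) X≈0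

    solve-linear : ∀ {A B l m y} → A * l + B * m ≈ y * m → l * A ≈ (y - B) * m
    solve-linear {A} {B} {l} {m} {y} h = begin
        l * A                    ≈⟨ ≡→≈ (lA≡X-Bm A B l m) ⟩
        (A * l + B * m) - B * m  ≈⟨ +-congʳ (- (B * m)) h ⟩
        y * m - B * m            ≈⟨ ≡→≈ (ym-Bm≡[y-B]m y B m) ⟩
        (y - B) * m              ∎
      where open ≈R

    form-A≈0 : ∀ {A B C l m} → A ≈ 0ℤ → binForm A B C (l , m) ≈ m * (+ 2 * B * l + C * m)
    form-A≈0 {A} {B} {C} {l} {m} zA =
      ≈-trans (+-congʳ (C * (m * m)) (+-congʳ (+ 2 * B * (l * m)) (≈0-mul zA))) (≡→≈ (form-A≡0 B C l m))

    disc-A≈0 : ∀ {A B C} → A ≈ 0ℤ → disc A B C ≈ B * B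
    disc-A≈0 {A} {B} {C} zA = ≈-trans (+-congˡ (B * B) (≈-trans (neg-cong (≈0-mul zA)) (≡→≈ neg0))) (≡→≈ (+-identityʳ (B * B)))

    [1,0]-root : ∀ {A B C} → A ≈ 0ℤ → Root A B C (1ℤ , 0ℤ)
    [1,0]-root {A} {B} {C} zA = ≈-trans (form-A≈0 {A} {B} {C} {1ℤ} {0ℤ} zA) (≡→≈ (*-zeroˡ _))

  noRoot-nonsquare : ∀ A B C → ¬ Sq (disc A B C) → ∀ s → NZ2 s → ¬ Root A B C s
  noRoot-nonsquare A B C nsq (l , m) nz r with ≈0? A
  ... | no nA = nsq (sq-ratio (root⇒square {A} {B} {C} r) (m≉0 {A} {B} {C} nA r nz))
  ... | yes zA = nsq (B , ≈-sym (disc-A≈0 {A} {B} {C} zA))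

  private
    oneRoot-A≉0 : ∀ {A B C} → ≉0 A → disc A B C ≈ 0ℤ → OneRoot A B C
    oneRoot-A≉0 {A} {B} {C} nA zD = (- B , A) , (λ { (_ , a) → nA a }) , square⇒root nA X²≈Dm² , unique
      where
      X²≈Dm² : (A * (- B) + B * A) * (A * (- B) + B * A) ≈ disc A B C * (A * A)
      X²≈Dm² = ≈-trans (≡→≈ (X-at-[-B,A] A B)) (≈-sym (≈0-mul zD))
      unique : ∀ s → NZ2 s → Root A B C s → s ∝ (- B , A)
      unique (l , m) nz r = proportional nA (≈-trans (solve-linear {A} {B} {l} {m} {0ℤ} X≈0) (≡→≈ ([0-B]m≡[-B]m B m)))
        where
        X≈0 : A * l + B * m ≈ 0ℤ * m
        X≈0 = ≈-trans (sq≈0 (≈-trans (root⇒square {A} {B} {C} r) (≈0-mul zD))) (≡→≈ (sym (*-zeroˡ m)))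

    oneRoot-A≈0 : ∀ {A B C} → A ≈ 0ℤ → ≉0 C → disc A B C ≈ 0ℤ → OneRoot A B C
    oneRoot-A≈0 {A} {B} {C} zA nC zD = (1ℤ , 0ℤ) , (λ { (a , _) → 1≉0 a }) , [1,0]-root {A} {B} {C} zA , unique
      where
      zB : B ≈ 0ℤ
      zB = sq≈0 (≈-trans (≈-sym (disc-A≈0 {A} {B} {C} zA)) zD)
      form≈Cm² : ∀ l m → m * (+ 2 * B * l + C * m) ≈ C * (m * m)
      form≈Cm² l m = ≈-trans (*-congˡ m (≈-trans (+-congʳ (C * m) (≈0-mul {+ 2 * B} {l} (≈0-mulˡ {+ 2} zB))) (≡→≈ (+-identityˡ (C * m)))))
                  (≡→≈ (m[Cm]≡C[mm] m C))
      unique : ∀ s → NZ2 s → Root A B C s → s ∝ (1ℤ , 0ℤ)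
      unique (l , m) nz r = proportional-[1,0] (sq≈0 (cancel-≈0 nC
        (≈-trans (≈-sym (form≈Cm² l m)) (≈-trans (≈-sym (form-A≈0 {A} {B} {C} {l} {m} zA)) r))))

  oneRoot-zero : ∀ A B C → disc A B C ≈ 0ℤ → ¬ ((A ≈ 0ℤ) × (B ≈ 0ℤ) × (C ≈ 0ℤ)) → OneRoot A B C
  oneRoot-zero A B C zD nall with ≈0? A
  ... | no nA = oneRoot-A≉0 nA zD
  ... | yes zA = oneRoot-A≈0 zA (λ zC → nall (zA , sq≈0 (≈-trans (≈-sym (disc-A≈0 {A} {B} {C} zA)) zD) , zC)) zD

  private
    twoRoots-A≉0 : ∀ {A B C σ} → ≉0 A → ≉0 σ → disc A B C ≈ σ * σ → TwoRoots A B C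
    twoRoots-A≉0 {A} {B} {C} {σ} nA nσ eD =
      (σ - B , A) , (- σ - B , A) , (λ { (_ , a) → nA a }) , (λ { (_ , a) → nA a }) ,
      square⇒root nA (≈-trans (≡→≈ (X-at-[σ-B,A] A B σ)) (*-congʳ (A * A) (≈-sym eD))) ,
      square⇒root nA (≈-trans (≡→≈ (X-at-[-σ-B,A] A B σ)) (*-congʳ (A * A) (≈-sym eD))) ,
      ≉0-resp (≡→≈ (sym (det-[σ-B,A]-[-σ-B,A] A B σ))) (mul≉0 (mul≉0 2≉0 nσ) nA) , which
      where
      which : ∀ s → NZ2 s → Root A B C s → (s ∝ (σ - B , A)) ⊎ (s ∝ (- σ - B , A))
      which (l , m) nz r with sqrt-eq {A * l + B * m} {σ * m}
        (≈-trans (root⇒square {A} {B} {C} r) (≈-trans (*-congʳ (m * m) eD) (≡→≈ (σ²m²≡[σm]² σ m))))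
      ... | inj₁ X≈σm = inj₁ (proportional nA (solve-linear {A} {B} {l} {m} {σ} X≈σm))
      ... | inj₂ X≈-σm = inj₂ (proportional nA (solve-linear {A} {B} {l} {m} {y = - σ} (≈-trans X≈-σm (≡→≈ (neg-distribˡ-* σ m)))))

    twoRoots-A≈0 : ∀ {A B C σ} → A ≈ 0ℤ → ≉0 σ → disc A B C ≈ σ * σ → TwoRoots A B C
    twoRoots-A≈0 {A} {B} {C} {σ} zA nσ eD =
      (1ℤ , 0ℤ) , (- C , + 2 * B) , (λ { (a , _) → 1≉0 a }) , (λ { (_ , a) → n2B a }) ,
      [1,0]-root {A} {B} {C} zA , ≈-trans (form-A≈0 {A} {B} {C} {l = - C} {m = + 2 * B} zA) (≡→≈ (form-at-[-C,2B] B C)) ,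
      ≉0-resp (≡→≈ (sym (det-[1,0]-[-C,2B] B C))) n2B , which
      where
      n2B : ≉0 (+ 2 * B)
      n2B = mul≉0 2≉0 (λ zB → nσ (sq≈0 (≈-trans (≈-sym eD) (≈-trans (disc-A≈0 {A} {B} {C} zA) (≈0-mul zB)))))
      which : ∀ s → NZ2 s → Root A B C s → (s ∝ (1ℤ , 0ℤ)) ⊎ (s ∝ (- C , + 2 * B))
      which (l , m) nz r with domain m (+ 2 * B * l + C * m) (≈-trans (≈-sym (form-A≈0 {A} {B} {C} {l} {m} zA)) r)
      ... | inj₁ m≈0 = inj₁ (proportional-[1,0] m≈0)
      ... | inj₂ Y≈0 = inj₂ (proportional n2B
        (≈-trans (≡→≈ (l[2B]≡Y-Cm B C l m)) (≈-trans (+-congʳ (- (C * m)) Y≈0) (≡→≈ (0-Cm≡[-C]m C m)))))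

  twoRoots-square : ∀ A B C σ → ≉0 σ → disc A B C ≈ σ * σ → TwoRoots A B C
  twoRoots-square A B C σ nσ eD with ≈0? A
  ... | no nA = twoRoots-A≉0 nA nσ eD
  ... | yes zA = twoRoots-A≈0 zA nσ eD


-- A diagonal conic Q_e(v) = e₁x² + e₂y² + e₃z² and a line L = [a:b:d].  In a basis U, V of L
-- the restricted form has discriminant -κ²Δ(e,L), so L meets the conic in 0, 1 or 2 points.
module ConicLine (q : ℕ) (pr : Prime (ℕ.suc q)) (p≥3 : 3 ≤ ℕ.suc q) where

  open import Defs
  open Counting
  open import Data.Nat as ℕ using (ℕ; zero; suc)
  open import Data.Nat.Primality using (Prime)
  open import Data.Integer as ℤ using (ℤ; +_)
  open IntegerOps
  import Data.Integer.Tactic.RingSolver as ZS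
  open import Data.Bool using (Bool; true)
  open import Data.List using (List; []; _∷_)
  open import Data.List.Membership.Propositional using (_∈_)
  open import Data.List.Relation.Unary.Any using (here; there)
  open import Data.List.Relation.Unary.AllPairs using (_∷_; [])
  open import Data.List.Relation.Unary.All as All using (All)
  open import Data.Product using (Σ; _×_; _,_; proj₁; proj₂)
  open import Data.Sum using (inj₁; inj₂)
  open import Data.Empty using (⊥; ⊥-elim)
  open import Relation.Nullary using (¬_; yes; no; contradiction)
  open import Relation.Binary.PropositionalEquality as Eq using (_≡_; refl; cong; sym; trans)

  open ProjectivePlane q pr p≥3 public
  open BinaryForms q pr p≥3 public

  Qf : T3 → T3 → ℤ
  Qf e v = c1 e * (c1 v * c1 v) + c2 e * (c2 v * c2 v) + c3 e * (c3 v * c3 v)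

  Bil : T3 → T3 → T3 → ℤ
  Bil e u v = c1 e * (c1 u * c1 v) + c2 e * (c2 u * c2 v) + c3 e * (c3 u * c3 v)

  dot : T3 → T3 → ℤ
  dot u v = c1 u * c1 v + c2 u * c2 v + c3 u * c3 v

  -- Δ(e,L) = e₂e₃a² + e₁e₃b² + e₁e₂d²: the dual form evaluated at L = [a:b:d]
  Δ : T3 → T3 → ℤ
  Δ e L = (c2 e * c3 e) * (c1 L * c1 L) + (c1 e * c3 e) * (c2 L * c2 L) + (c1 e * c2 e) * (c3 L * c3 L)

  lin : ℤ → ℤ → T3 → T3 → T3
  lin l m U V = (l * c1 U + m * c1 V , l * c2 U + m * c2 V , l * c3 U + m * c3 V)

  Qf-cong : ∀ e {v w} → v ≈₃ w → Qf e v ≈ Qf e w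
  Qf-cong e (≈₃c (a , b , c)) = +-cong (+-cong (*-congˡ (c1 e) (*-cong a a)) (*-congˡ (c2 e) (*-cong b b))) (*-congˡ (c3 e) (*-cong c c))

  dot-cong : ∀ L {v w} → v ≈₃ w → dot L v ≈ dot L w
  dot-cong L (≈₃c (a , b , c)) = +-cong (+-cong (*-congˡ (c1 L) a) (*-congˡ (c2 L) b)) (*-congˡ (c3 L) c)

  lin-cong : ∀ {l l' m m'} U V → l ≈ l' → m ≈ m' → lin l m U V ≈₃ lin l' m' U V
  lin-cong U V a b = ≈₃c (+-cong (*-congʳ (c1 U) a) (*-congʳ (c1 V) b) , +-cong (*-congʳ (c2 U) a) (*-congʳ (c2 V) b) , +-cong (*-congʳ (c3 U) a) (*-congʳ (c3 V) b))

  private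
    opaque
     unfolding _+_ _*_ -_
     l-Qs : ∀ e1 e2 e3 t a b c → e1 * ((t * a) * (t * a)) + e2 * ((t * b) * (t * b)) + e3 * ((t * c) * (t * c))
                                ≡ (t * t) * (e1 * (a * a) + e2 * (b * b) + e3 * (c * c))
     l-Qs = ZS.solve-∀
    opaque
     unfolding _+_ _*_ -_
     l-ds : ∀ l1 l2 l3 t a b c → l1 * (t * a) + l2 * (t * b) + l3 * (t * c) ≡ t * (l1 * a + l2 * b + l3 * c)
     l-ds = ZS.solve-∀
    opaque
     unfolding _+_ _*_ -_
     l-Ql : ∀ e1 e2 e3 l m u1 u2 u3 v1 v2 v3 →
        e1 * ((l * u1 + m * v1) * (l * u1 + m * v1)) + e2 * ((l * u2 + m * v2) * (l * u2 + m * v2)) + e3 * ((l * u3 + m * v3) * (l * u3 + m * v3))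
        ≡ (e1 * (u1 * u1) + e2 * (u2 * u2) + e3 * (u3 * u3)) * (l * l) + + 2 * (e1 * (u1 * v1) + e2 * (u2 * v2) + e3 * (u3 * v3)) * (l * m)
          + (e1 * (v1 * v1) + e2 * (v2 * v2) + e3 * (v3 * v3)) * (m * m)
     l-Ql = ZS.solve-∀
    opaque
     unfolding _+_ _*_ -_
     l-dl : ∀ a b c l m u1 u2 u3 v1 v2 v3 → a * (l * u1 + m * v1) + b * (l * u2 + m * v2) + c * (l * u3 + m * v3)
        ≡ l * (a * u1 + b * u2 + c * u3) + m * (a * v1 + b * v2 + c * v3)
     l-dl = ZS.solve-∀
    opaque
     unfolding _+_ _*_ -_
     l-ls : ∀ t r1 r2 u v → (t * r1) * u + (t * r2) * v ≡ t * (r1 * u + r2 * v)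
     l-ls = ZS.solve-∀
    opaque
     unfolding _+_ _*_ -_
     l-lsub : ∀ a b a' b' u v → (a - a') * u + (b - b') * v ≡ (a * u + b * v) - (a' * u + b' * v)
     l-lsub = ZS.solve-∀

  Qf-scale : ∀ e t v → Qf e (scale t v) ≡ (t * t) * Qf e v
  Qf-scale e t v = l-Qs (c1 e) (c2 e) (c3 e) t (c1 v) (c2 v) (c3 v)

  dot-scale : ∀ L t v → dot L (scale t v) ≡ t * dot L v
  dot-scale L t v = l-ds (c1 L) (c2 L) (c3 L) t (c1 v) (c2 v) (c3 v)

  Qf-lin : ∀ e l m U V → Qf e (lin l m U V) ≡ binForm (Qf e U) (Bil e U V) (Qf e V) (l , m)
  Qf-lin e l m U V = l-Ql (c1 e) (c2 e) (c3 e) l m (c1 U) (c2 U) (c3 U) (c1 V) (c2 V) (c3 V)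

  dot-lin : ∀ L l m U V → dot L (lin l m U V) ≡ l * dot L U + m * dot L V
  dot-lin L l m U V = l-dl (c1 L) (c2 L) (c3 L) l m (c1 U) (c2 U) (c3 U) (c1 V) (c2 V) (c3 V)

  lin-scale : ∀ t r1 r2 U V → lin (t * r1) (t * r2) U V ≈₃ scale t (lin r1 r2 U V)
  lin-scale t r1 r2 U V = ≈₃c (≡→≈ (l-ls t r1 r2 (c1 U) (c1 V)) , ≡→≈ (l-ls t r1 r2 (c2 U) (c2 V)) , ≡→≈ (l-ls t r1 r2 (c3 U) (c3 V)))

  record LineBasis (e L : T3) : Set where
    field
      U V : T3
      spans : ∀ X → dot L X ≈ 0ℤ → Σ ℤ λ l → Σ ℤ λ m → X ≈₃ lin l m U V
      independent : ∀ l m → Zero3 (lin l m U V) → (l ≈ 0ℤ) × (m ≈ 0ℤ)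
      U-on-L : dot L U ≈ 0ℤ
      V-on-L : dot L V ≈ 0ℤ
      κ : ℤ
      κ≉0 : ≉0 κ
      gram≈κ²Δ : Qf e U * Qf e V - Bil e U V * Bil e U V ≈ (κ * κ) * Δ e L
      restriction≢0 : ¬ ((Qf e U ≈ 0ℤ) × (Bil e U V ≈ 0ℤ) × (Qf e V ≈ 0ℤ))

  OnBoth : T3 → T3 → Triple → Set
  OnBoth e L X = (Qf e (ι X) ≈ 0ℤ) × (dot L (ι X) ≈ 0ℤ)

  module OnLine (e L : T3) (S : LineBasis e L) where
    open LineBasis S
    A B C : ℤ
    A = Qf e U
    B = Bil e U V
    C = Qf e V

    private
      opaque
       unfolding _+_ _*_ -_
       l-disc : ∀ A B C → B * B - A * C ≡ - (A * C - B * B)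
       l-disc = ZS.solve-∀
      opaque
       unfolding _+_ _*_ -_
       l-kd : ∀ k d → - ((k * k) * d) ≡ (k * k) * (- d)
       l-kd = ZS.solve-∀

    D≈ : disc A B C ≈ (κ * κ) * (- Δ e L)
    D≈ = ≈-trans (≡→≈ (l-disc A B C)) (≈-trans (neg-cong gram≈κ²Δ) (≡→≈ (l-kd κ (Δ e L))))

    lin0 : ∀ {l m} → l ≈ 0ℤ → m ≈ 0ℤ → Zero3 (lin l m U V)
    lin0 {l} {m} a b = z (c1 U) (c1 V) , z (c2 U) (c2 V) , z (c3 U) (c3 V)
      where
      z : ∀ u v → l * u + m * v ≈ 0ℤ
      z u v = ≈-trans (+-cong (*-congʳ u a) (*-congʳ v b)) (≡→≈ (ez u v))
        where
              opaque
               unfolding _+_ _*_ -_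
               ez : ∀ u v → + 0 * u + + 0 * v ≡ + 0
               ez = ZS.solve-∀

    nzlin : ∀ r → NZ2 r → NZ (lin (proj₁ r) (proj₂ r) U V)
    nzlin (l , m) nz z = nz (independent l m z)

    pointOf : ∀ r → NZ2 r → Triple
    pointOf r nz = norm (lin (proj₁ r) (proj₂ r) U V) (nzlin r nz)

    pointOf-Norm : ∀ r nz → Norm (pointOf r nz)
    pointOf-Norm r nz = norm-Norm _ (nzlin r nz)

    root⇒point : ∀ r nz → Root A B C r → OnBoth e L (pointOf r nz)
    root⇒point (l , m) nz rt with norm-∼ (lin l m U V) (nzlin (l , m) nz)
    ... | t , nt , E =
      ≈-trans (Qf-cong e E) (≈-trans (≡→≈ (trans (Qf-scale e t (lin l m U V)) (cong ((t * t) *_) (Qf-lin e l m U V))))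
        (≈-trans (*-congˡ (t * t) rt) (≡→≈ (*-zeroʳ (t * t))))) ,
      ≈-trans (dot-cong L E) (≈-trans (≡→≈ (trans (dot-scale L t (lin l m U V)) (cong (t *_) (dot-lin L l m U V))))
        (≈-trans (*-congˡ t (+-cong (*-congˡ l U-on-L) (*-congˡ m V-on-L))) (≡→≈ (ez t l m))))
      where
            opaque
             unfolding _+_ _*_ -_
             ez : ∀ t l m → t * (l * + 0 + m * + 0) ≡ + 0
             ez = ZS.solve-∀

    point⇒root : ∀ X → Norm X → OnBoth e L X → Σ (ℤ × ℤ) λ s → NZ2 s × Root A B C s × (ι X ≈₃ lin (proj₁ s) (proj₂ s) U V)
    point⇒root X nX (zq , zd) with spans (ι X) zd
    ... | l , m , E = (l , m) , nz , ≈-trans (≡→≈ (sym (Qf-lin e l m U V))) (≈-trans (Qf-cong e (≈₃-sym E)) zq) , E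
      where
      nz : NZ2 (l , m)
      nz (a , b) = Norm-NZ nX (NZ-zero (≈₃-sym E) (lin0 a b))
        where
        NZ-zero : ∀ {v w} → v ≈₃ w → Zero3 v → Zero3 w
        NZ-zero (≈₃c (a , b , c)) (a' , b' , c') = ≈-trans (≈-sym a) a' , ≈-trans (≈-sym b) b' , ≈-trans (≈-sym c) c'

    proportional⇒pointOf : ∀ X s r (nr : NZ2 r) → Norm X → ι X ≈₃ lin (proj₁ s) (proj₂ s) U V → NZ2 s → s ∝ r → X ≡ pointOf r nr
    proportional⇒pointOf X (l , m) (r1 , r2) nr nX E ns (t , a , b) = Norm-uniq nX (pointOf-Norm (r1 , r2) nr)
         (∼-trans (t , nt , ≈₃-trans E (≈₃-trans (lin-cong U V a b) (lin-scale t r1 r2 U V)))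
                  (∼-sym (norm-∼ (lin r1 r2 U V) (nzlin (r1 , r2) nr))))
      where
      nt : ≉0 t
      nt zt = ns (≈-trans a (≈-trans (*-congʳ r1 zt) (≡→≈ (*-zeroˡ r1))) , ≈-trans b (≈-trans (*-congʳ r2 zt) (≡→≈ (*-zeroˡ r2))))

    pointOf-distinct : ∀ r r' (nr : NZ2 r) (nr' : NZ2 r') → ≉0 (det r r') → pointOf r nr ≡ pointOf r' nr' → ⊥
    pointOf-distinct (r1 , r2) (r1' , r2') nr nr' nd eq = nd detz
      where
      w : lin r1 r2 U V ∼ lin r1' r2' U V
      w = ∼-trans (∼-sym (norm-∼ (lin r1 r2 U V) (nzlin (r1 , r2) nr)))
            (Eq.subst (λ Y → ι Y ∼ lin r1' r2' U V) (sym eq) (norm-∼ (lin r1' r2' U V) (nzlin (r1' , r2') nr')))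
      t : ℤ
      t = proj₁ w
      E : lin r1 r2 U V ≈₃ lin (t * r1') (t * r2') U V
      E = ≈₃-trans (proj₂ (proj₂ w)) (≈₃-sym (lin-scale t r1' r2' U V))
      sub : ∀ {a b a' b'} u v → a * u + b * v ≈ a' * u + b' * v → (a - a') * u + (b - b') * v ≈ 0ℤ
      sub {a} {b} {a'} {b'} u v h = ≈-trans (≡→≈ (l-lsub a b a' b' u v)) (≈→≈0 h)
      z3 : Zero3 (lin (r1 - t * r1') (r2 - t * r2') U V)
      z3 with E
      ... | ≈₃c (x , y , z) = sub (c1 U) (c1 V) x , sub (c2 U) (c2 V) y , sub (c3 U) (c3 V) z
      h12 : (r1 - t * r1' ≈ 0ℤ) × (r2 - t * r2' ≈ 0ℤ)
      h12 = independent (r1 - t * r1') (r2 - t * r2') z3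
      detz : det (r1 , r2) (r1' , r2') ≈ 0ℤ
      detz = ≈-trans (+-cong (*-congʳ r2' (≈0→≈ (proj₁ h12))) (neg-cong (*-congʳ r1' (≈0→≈ (proj₂ h12)))))
                 (≡→≈ (ez t r1' r2'))
        where
              opaque
               unfolding _+_ _*_ -_
               ez : ∀ t a b → (t * a) * b + - ((t * b) * a) ≡ + 0
               ez = ZS.solve-∀

    module CountOnLine (g : Triple → Bool)
                 (g-sound : ∀ X → Norm X → g X ≡ true → OnBoth e L X)
                 (g-complete : ∀ X → Norm X → OnBoth e L X → g X ≡ true) where

      count-nonsquare : ¬ Sq (- Δ e L) → count g (PG2 p) ≡ 0
      count-nonsquare nsq = count≡length g PG2-unique [] (λ z ()) h2
        where
        nD : ¬ Sq (disc A B C)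
        nD sq = nsq (Sq-resp ee (Sq-* (Sq-resp D≈ sq) (inv κ , ≈-refl)))
          where
          ee : (κ * κ) * (- Δ e L) * (inv κ * inv κ) ≈ - Δ e L
          ee = ≈-trans (≡→≈ (lk κ (inv κ) (- Δ e L))) (≈-trans (*-congʳ (- Δ e L) (*-cong (inv-ok κ≉0) (inv-ok κ≉0))) (≡→≈ (l1 (- Δ e L))))
            where
            opaque
             unfolding _+_ _*_ -_
             lk : ∀ k i d → (k * k) * d * (i * i) ≡ ((k * i) * (k * i)) * d
             lk = ZS.solve-∀
             l1 : ∀ d → (+ 1 * + 1) * d ≡ d
             l1 = ZS.solve-∀
        h2 : ∀ z → z ∈ PG2 p → g z ≡ true → z ∈ []
        h2 z m gz with point⇒root z (PG2-Norm m) (g-sound z (PG2-Norm m) gz)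
        ... | s , ns , rs , _ = ⊥-elim (noRoot-nonsquare A B C nD s ns rs)

      count-zero : Δ e L ≈ 0ℤ → count g (PG2 p) ≡ 1
      count-zero zΔ with oneRoot-zero A B C zD restriction≢0
        where
        zD : disc A B C ≈ 0ℤ
        zD = ≈-trans D≈ (≈-trans (*-congˡ (κ * κ) (≈-trans (neg-cong zΔ) (≡→≈ neg0))) (≡→≈ (*-zeroʳ (κ * κ))))
      ... | r , nr , rr , allr = count≡length g PG2-unique (All.[] ∷ []) h1 h2
        where
        h1 : ∀ z → z ∈ (pointOf r nr ∷ []) → z ∈ PG2 p × g z ≡ true
        h1 z (here refl) = Norm-PG2 (pointOf-Norm r nr) , g-complete _ (pointOf-Norm r nr) (root⇒point r nr rr)
        h2 : ∀ z → z ∈ PG2 p → g z ≡ true → z ∈ (pointOf r nr ∷ [])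
        h2 z m gz with point⇒root z (PG2-Norm m) (g-sound z (PG2-Norm m) gz)
        ... | s , ns , rs , E = here (proportional⇒pointOf z s r nr (PG2-Norm m) E ns (allr s ns rs))

      count-square : Sq (- Δ e L) → ≉0 (Δ e L) → count g (PG2 p) ≡ 2
      count-square (w , ew) nΔ with twoRoots-square A B C (κ * w) nσ eD
        where
        nw : ≉0 w
        nw zw = nΔ (neg≈0 (≈-trans (≈-sym ew) (≈0-mul zw)))
        nσ : ≉0 (κ * w)
        nσ = mul≉0 κ≉0 nw
        eD : disc A B C ≈ (κ * w) * (κ * w)
        eD = ≈-trans D≈ (≈-trans (*-congˡ (κ * κ) (≈-sym ew)) (≡→≈ (lk κ w)))
          where
          opaque
           unfolding _+_ _*_ -_
           lk : ∀ k w → (k * k) * (w * w) ≡ (k * w) * (k * w)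
           lk = ZS.solve-∀
      ... | r , r' , nr , nr' , rr , rr' , nd , allr = count≡length g PG2-unique (ne ∷ (All.[] ∷ [])) h1 h2
        where
        ne : All (λ y → pointOf r nr Eq.≢ y) (pointOf r' nr' ∷ [])
        ne = (λ eq → pointOf-distinct r r' nr nr' nd eq) All.∷ All.[]
        h1 : ∀ z → z ∈ (pointOf r nr ∷ pointOf r' nr' ∷ []) → z ∈ PG2 p × g z ≡ true
        h1 z (here refl) = Norm-PG2 (pointOf-Norm r nr) , g-complete _ (pointOf-Norm r nr) (root⇒point r nr rr)
        h1 z (there (here refl)) = Norm-PG2 (pointOf-Norm r' nr') , g-complete _ (pointOf-Norm r' nr') (root⇒point r' nr' rr')
        h2 : ∀ z → z ∈ PG2 p → g z ≡ true → z ∈ (pointOf r nr ∷ pointOf r' nr' ∷ [])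
        h2 z m gz with point⇒root z (PG2-Norm m) (g-sound z (PG2-Norm m) gz)
        ... | s , ns , rs , E with allr s ns rs
        ...   | inj₁ pr1 = here (proportional⇒pointOf z s r nr (PG2-Norm m) E ns pr1)
        ...   | inj₂ pr2 = there (here (proportional⇒pointOf z s r' nr' (PG2-Norm m) E ns pr2))

      count≡1⇒Δ≈0 : count g (PG2 p) ≡ 1 → Δ e L ≈ 0ℤ
      count≡1⇒Δ≈0 one with ≈0? (Δ e L)
      ... | yes Δ≈0 = Δ≈0
      ... | no Δ≉0 with Sq? (- Δ e L)
      ...   | yes sq = contradiction (trans (sym (count-square sq Δ≉0)) one) λ ()
      ...   | no nsq = contradiction (trans (sym (count-nonsquare nsq)) one) λ ()

      count≡2⇒NSq : count g (PG2 p) ≡ 2 → NSq (- Δ e L)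
      count≡2⇒NSq two with ≈0? (Δ e L)
      ... | yes Δ≈0 = contradiction (trans (sym (count-zero Δ≈0)) two) λ ()
      ... | no Δ≉0 with Sq? (- Δ e L)
      ...   | yes sq = sq , λ -Δ≈0 → Δ≉0 (neg≈0 -Δ≈0)
      ...   | no nsq = contradiction (trans (sym (count-nonsquare nsq)) two) λ ()

  Δ-cong : ∀ e {L L'} → L ≈₃ L' → Δ e L ≈ Δ e L'
  Δ-cong e (≈₃c (a , b , c)) = +-cong (+-cong (*-congˡ (c2 e * c3 e) (*-cong a a)) (*-congˡ (c1 e * c3 e) (*-cong b b))) (*-congˡ (c1 e * c2 e) (*-cong c c))

  private
    opaque
      unfolding _+_ _*_ -_
      a-hu : ∀ a b d → a * (- b) + b * a + d * + 0 ≡ + 0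
      a-hu = ZS.solve-∀
      a-hv : ∀ a b d → a * (- d) + b * + 0 + d * a ≡ + 0
      a-hv = ZS.solve-∀
      a-hΔ : ∀ e1 e2 e3 a b d →
        (e1 * ((- b) * (- b)) + e2 * (a * a) + e3 * (+ 0 * + 0)) * (e1 * ((- d) * (- d)) + e2 * (+ 0 * + 0) + e3 * (a * a))
        - (e1 * ((- b) * (- d)) + e2 * (a * + 0) + e3 * (+ 0 * a)) * (e1 * ((- b) * (- d)) + e2 * (a * + 0) + e3 * (+ 0 * a))
        ≡ (a * a) * ((e2 * e3) * (a * a) + (e1 * e3) * (b * b) + (e1 * e2) * (d * d))
      a-hΔ = ZS.solve-∀
      a-c1e : ∀ x y z a b d → a * x + b * y + d * z ≡ x * a + (b * y + d * z)
      a-c1e = ZS.solve-∀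
      a-c1f : ∀ y z i b d → (y * i) * (- b) + (z * i) * (- d) ≡ (- (b * y + d * z)) * i
      a-c1f = ZS.solve-∀
      a-c2g : ∀ l m a → l * a + m * + 0 ≡ l * a
      a-c2g = ZS.solve-∀
      a-c3g : ∀ l m a → l * + 0 + m * a ≡ m * a
      a-c3g = ZS.solve-∀
      a-qU : ∀ e1 e2 e3 a b → e1 * ((- b) * (- b)) + e2 * (a * a) + e3 * (+ 0 * + 0) ≡ e1 * (b * b) + e2 * (a * a)
      a-qU = ZS.solve-∀
      a-qV : ∀ e1 e2 e3 a d → e1 * ((- d) * (- d)) + e2 * (+ 0 * + 0) + e3 * (a * a) ≡ e1 * (d * d) + e3 * (a * a)
      a-qV = ZS.solve-∀
      a-bil : ∀ e1 e2 e3 a b d → e1 * ((- b) * (- d)) + e2 * (a * + 0) + e3 * (+ 0 * a) ≡ e1 * (b * d)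
      a-bil = ZS.solve-∀

  lineBasis-a : ∀ e1 e2 e3 a b d → ≉0 e1 → ≉0 e2 → ≉0 e3 → ≉0 a → LineBasis (e1 , e2 , e3) (a , b , d)
  lineBasis-a e1 e2 e3 a b d n1 n2 n3 na = record
    { U = (- b , a , 0ℤ) ; V = (- d , 0ℤ , a)
    ; spans = spans ; independent = independent ; U-on-L = ≡→≈ (a-hu a b d) ; V-on-L = ≡→≈ (a-hv a b d)
    ; κ = a ; κ≉0 = na ; gram≈κ²Δ = ≡→≈ (a-hΔ e1 e2 e3 a b d) ; restriction≢0 = restriction≢0 }
    where
    neg-sol : ∀ {x y z} → a * x + b * y + d * z ≈ 0ℤ → x * a ≈ - (b * y + d * z)
    neg-sol {x} {y} {z} h = neg-of (≈-trans (≡→≈ (sym (a-c1e x y z a b d))) h)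
    spans : ∀ X → dot (a , b , d) X ≈ 0ℤ → Σ ℤ λ l → Σ ℤ λ m → X ≈₃ lin l m (- b , a , 0ℤ) (- d , 0ℤ , a)
    spans (x , y , z) h = y * inv a , z * inv a , ≈₃c (e1' , e2' , e3')
      where
      e1' : x ≈ (y * inv a) * (- b) + (z * inv a) * (- d)
      e1' = ≈-trans (div-intro na (neg-sol h)) (≡→≈ (sym (a-c1f y z (inv a) b d)))
      e2' : y ≈ (y * inv a) * a + (z * inv a) * + 0
      e2' = ≈-sym (≈-trans (≡→≈ (a-c2g (y * inv a) (z * inv a) a)) (inv-cancel y na))
      e3' : z ≈ (y * inv a) * + 0 + (z * inv a) * a
      e3' = ≈-sym (≈-trans (≡→≈ (a-c3g (y * inv a) (z * inv a) a)) (inv-cancel z na))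
    independent : ∀ l m → Zero3 (lin l m (- b , a , 0ℤ) (- d , 0ℤ , a)) → (l ≈ 0ℤ) × (m ≈ 0ℤ)
    independent l m (_ , z2 , z3) = cancel-≈0ʳ na (≈-trans (≡→≈ (sym (a-c2g l m a))) z2) , cancel-≈0ʳ na (≈-trans (≡→≈ (sym (a-c3g l m a))) z3)
    restriction≢0 : ¬ ((Qf (e1 , e2 , e3) (- b , a , 0ℤ) ≈ 0ℤ) × (Bil (e1 , e2 , e3) (- b , a , 0ℤ) (- d , 0ℤ , a) ≈ 0ℤ) × (Qf (e1 , e2 , e3) (- d , 0ℤ , a) ≈ 0ℤ))
    restriction≢0 (zU , zB , zV) with domain e1 (b * d) (≈-trans (≡→≈ (sym (a-bil e1 e2 e3 a b d))) zB)
    ... | inj₁ z = n1 z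
    ... | inj₂ z with domain b d z
    ...   | inj₁ zb = mul≉0 n2 (mul≉0 na na) (≈-trans (≈-sym (≈-trans (+-congʳ (e2 * (a * a)) (*-congˡ e1 (≈0-mul zb)))
                         (≡→≈ (trans (cong (_+ e2 * (a * a)) (*-zeroʳ e1)) (+-identityˡ _))))) (≈-trans (≡→≈ (sym (a-qU e1 e2 e3 a b))) zU))
    ...   | inj₂ zd = mul≉0 n3 (mul≉0 na na) (≈-trans (≈-sym (≈-trans (+-congʳ (e3 * (a * a)) (*-congˡ e1 (≈0-mul zd)))
                         (≡→≈ (trans (cong (_+ e3 * (a * a)) (*-zeroʳ e1)) (+-identityˡ _))))) (≈-trans (≡→≈ (sym (a-qV e1 e2 e3 a d))) zV))

  private
    opaque
     unfolding _+_ _*_ -_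
     r-l1 : ∀ l m → l * + 1 + m * + 0 ≡ l
     r-l1 = ZS.solve-∀
     r-l2 : ∀ l m → l * + 0 + m * + 1 ≡ m
     r-l2 = ZS.solve-∀
     r-l0 : ∀ l m → l * + 0 + m * + 0 ≡ + 0
     r-l0 = ZS.solve-∀
     r-QU : ∀ e1 e2 e3 → e1 * (+ 1 * + 1) + e2 * (+ 0 * + 0) + e3 * (+ 0 * + 0) ≡ e1
     r-QU = ZS.solve-∀
     r-ax : ∀ a x b y d z → a * x + b * y + d * z ≡ a * x + (b * y + d * z)
     r-ax = ZS.solve-∀
     r-ax2 : ∀ a x b y d z → a * x + b * y + d * z ≡ (a * x + b * y) + d * z
     r-ax2 = ZS.solve-∀

  private
    opaque
      unfolding _+_ _*_ -_
      b-r-l0' : ∀ a b d → a * + 1 + b * + 0 + d * + 0 ≡ a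
      b-r-l0' = ZS.solve-∀
      b-hv : ∀ a b d → a * + 0 + b * (- d) + d * b ≡ + 0
      b-hv = ZS.solve-∀
      b-hΔ : ∀ e1 e2 e3 b d →
        (e1 * (+ 1 * + 1) + e2 * (+ 0 * + 0) + e3 * (+ 0 * + 0)) * (e1 * (+ 0 * + 0) + e2 * ((- d) * (- d)) + e3 * (b * b))
        - (e1 * (+ 1 * + 0) + e2 * (+ 0 * (- d)) + e3 * (+ 0 * b)) * (e1 * (+ 1 * + 0) + e2 * (+ 0 * (- d)) + e3 * (+ 0 * b))
        ≡ (+ 1 * + 1) * ((e2 * e3) * (+ 0 * + 0) + (e1 * e3) * (b * b) + (e1 * e2) * (d * d))
      b-hΔ = ZS.solve-∀
      b-c2f : ∀ x z i d → x * + 0 + (z * i) * (- d) ≡ (- (d * z)) * i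
      b-c2f = ZS.solve-∀
      b-c3f : ∀ x m b → x * + 0 + m * b ≡ m * b
      b-c3f = ZS.solve-∀
      b-byz : ∀ b y d z → b * y + d * z ≡ y * b + d * z
      b-byz = ZS.solve-∀

  lineBasis-b : ∀ e1 e2 e3 a b d → ≉0 e1 → a ≈ 0ℤ → ≉0 b → LineBasis (e1 , e2 , e3) (a , b , d)
  lineBasis-b e1 e2 e3 a b d n1 za nb = record
    { U = (1ℤ , 0ℤ , 0ℤ) ; V = (0ℤ , - d , b)
    ; spans = spans ; independent = independent ; U-on-L = ≈-trans (≡→≈ (b-r-l0' a b d)) za ; V-on-L = ≡→≈ (b-hv a b d)
    ; κ = 1ℤ ; κ≉0 = 1≉0 ; gram≈κ²Δ = ≈-trans (≡→≈ (b-hΔ e1 e2 e3 b d)) (*-congˡ (1ℤ * 1ℤ) (Δ-cong (e1 , e2 , e3) (≈₃c (≈-sym za , ≈-refl , ≈-refl))))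
    ; restriction≢0 = λ { (zU , _ , _) → n1 (≈-trans (≡→≈ (sym (r-QU e1 e2 e3))) zU) } }
    where
    spans : ∀ X → dot (a , b , d) X ≈ 0ℤ → Σ ℤ λ l → Σ ℤ λ m → X ≈₃ lin l m (1ℤ , 0ℤ , 0ℤ) (0ℤ , - d , b)
    spans (x , y , z) h = x , z * inv b , ≈₃c (≡→≈ (sym (r-l1 x (z * inv b))) , e2' , e3')
      where
      h' : y * b + d * z ≈ 0ℤ
      h' = ≈-trans (≡→≈ (sym (b-byz b y d z))) (≈0-summand (≈-trans (*-congʳ x za) (≡→≈ (*-zeroˡ x))) (≈-trans (≡→≈ (sym (r-ax a x b y d z))) h))
      e2' : y ≈ x * + 0 + (z * inv b) * (- d)
      e2' = ≈-trans (div-intro nb (neg-of h')) (≡→≈ (sym (b-c2f x z (inv b) d)))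
      e3' : z ≈ x * + 0 + (z * inv b) * b
      e3' = ≈-sym (≈-trans (≡→≈ (b-c3f x (z * inv b) b)) (inv-cancel z nb))
    independent : ∀ l m → Zero3 (lin l m (1ℤ , 0ℤ , 0ℤ) (0ℤ , - d , b)) → (l ≈ 0ℤ) × (m ≈ 0ℤ)
    independent l m (z1 , _ , z3) = ≈-trans (≡→≈ (sym (r-l1 l m))) z1 , cancel-≈0ʳ nb (≈-trans (≡→≈ (sym (b-c3f l m b))) z3)

  private
    opaque
      unfolding _+_ _*_ -_
      d-r-u : ∀ a b d → a * + 1 + b * + 0 + d * + 0 ≡ a
      d-r-u = ZS.solve-∀
      d-r-v : ∀ a b d → a * + 0 + b * + 1 + d * + 0 ≡ b
      d-r-v = ZS.solve-∀
      d-hΔ : ∀ e1 e2 e3 →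
        (e1 * (+ 1 * + 1) + e2 * (+ 0 * + 0) + e3 * (+ 0 * + 0)) * (e1 * (+ 0 * + 0) + e2 * (+ 1 * + 1) + e3 * (+ 0 * + 0))
        - (e1 * (+ 1 * + 0) + e2 * (+ 0 * + 1) + e3 * (+ 0 * + 0)) * (e1 * (+ 1 * + 0) + e2 * (+ 0 * + 1) + e3 * (+ 0 * + 0))
        ≡ e1 * e2
      d-hΔ = ZS.solve-∀
      d-hΔ2 : ∀ e1 e2 e3 d i → (i * i) * ((e2 * e3) * (+ 0 * + 0) + (e1 * e3) * (+ 0 * + 0) + (e1 * e2) * (d * d))
                           ≡ (e1 * e2) * ((d * i) * (d * i))
      d-hΔ2 = ZS.solve-∀
      d-hΔ3 : ∀ x → x * (+ 1 * + 1) ≡ x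
      d-hΔ3 = ZS.solve-∀

  lineBasis-d : ∀ e1 e2 e3 a b d → ≉0 e1 → a ≈ 0ℤ → b ≈ 0ℤ → ≉0 d → LineBasis (e1 , e2 , e3) (a , b , d)
  lineBasis-d e1 e2 e3 a b d n1 za zb nd = record
    { U = (1ℤ , 0ℤ , 0ℤ) ; V = (0ℤ , 1ℤ , 0ℤ)
    ; spans = spans ; independent = independent ; U-on-L = ≈-trans (≡→≈ (d-r-u a b d)) za ; V-on-L = ≈-trans (≡→≈ (d-r-v a b d)) zb
    ; κ = inv d ; κ≉0 = inv≉0 nd ; gram≈κ²Δ = hΔ'
    ; restriction≢0 = λ { (zU , _ , _) → n1 (≈-trans (≡→≈ (sym (r-QU e1 e2 e3))) zU) } }
    where
    hΔ' : _
    hΔ' = ≈-trans (≡→≈ (d-hΔ e1 e2 e3)) (≈-sym (≈-trans (*-congˡ (inv d * inv d) (Δ-cong (e1 , e2 , e3) (≈₃c (za , zb , ≈-refl))))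
             (≈-trans (≡→≈ (d-hΔ2 e1 e2 e3 d (inv d))) (≈-trans (*-congˡ (e1 * e2) (*-cong (inv-ok nd) (inv-ok nd))) (≡→≈ (d-hΔ3 (e1 * e2)))))))
    spans : ∀ X → dot (a , b , d) X ≈ 0ℤ → Σ ℤ λ l → Σ ℤ λ m → X ≈₃ lin l m (1ℤ , 0ℤ , 0ℤ) (0ℤ , 1ℤ , 0ℤ)
    spans (x , y , z) h = x , y , ≈₃c (≡→≈ (sym (r-l1 x y)) , ≡→≈ (sym (r-l2 x y)) , ≈-trans z0 (≡→≈ (sym (r-l0 x y))))
      where
      dz : d * z ≈ 0ℤ
      dz = ≈0-summand (≈-trans (+-cong (≈-trans (*-congʳ x za) (≡→≈ (*-zeroˡ x))) (≈-trans (*-congʳ y zb) (≡→≈ (*-zeroˡ y)))) (≡→≈ (+-identityˡ (+ 0))))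
             (≈-trans (≡→≈ (sym (r-ax2 a x b y d z))) h)
      z0 : z ≈ 0ℤ
      z0 with domain d z dz
      ... | inj₁ w = ⊥-elim (nd w)
      ... | inj₂ w = w
    independent : ∀ l m → Zero3 (lin l m (1ℤ , 0ℤ , 0ℤ) (0ℤ , 1ℤ , 0ℤ)) → (l ≈ 0ℤ) × (m ≈ 0ℤ)
    independent l m (z1 , z2 , _) = ≈-trans (≡→≈ (sym (r-l1 l m))) z1 , ≈-trans (≡→≈ (sym (r-l2 l m))) z2

  lineBasis : ∀ e L → ≉0 (c1 e) → ≉0 (c2 e) → ≉0 (c3 e) → NZ L → LineBasis e L
  lineBasis (e1 , e2 , e3) (a , b , d) n1 n2 n3 nz with ≈0? a | ≈0? b | ≈0? d
  ... | no na | _ | _ = lineBasis-a e1 e2 e3 a b d n1 n2 n3 na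
  ... | yes za | no nb | _ = lineBasis-b e1 e2 e3 a b d n1 za nb
  ... | yes za | yes zb | no nd = lineBasis-d e1 e2 e3 a b d n1 za zb nd
  ... | yes za | yes zb | yes zd = ⊥-elim (nz (za , zb , zd))


module Tangency (q : ℕ) (pr : Prime (ℕ.suc q)) (p≥3 : 3 ≤ ℕ.suc q) where

  open import Defs
  open BooleanFacts
  open import Data.Nat as ℕ using (ℕ; suc; _≡ᵇ_)
  import Data.Nat.Divisibility as ℕD
  open import Data.Nat.Primality using (Prime)
  open import Data.Integer as ℤ using (+_)
  open IntegerOps
  import Data.Integer.Tactic.RingSolver as ZS
  open import Data.Bool using (Bool; true; _∧_)
  open import Data.Product using (_,_; proj₁; proj₂)
  open import Relation.Binary.PropositionalEquality as Eq using (_≡_; cong; cong₂; sym; trans)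

  open ConicLine q pr p≥3 public

  isZero-≈ : ∀ n → isZero p n ≡ true → + n ≈ 0ℤ
  isZero-≈ n h = ℕ∣→≈0 (ℕD.m%n≡0⇒n∣m n p (≡ᵇ-true h))

  ≈-isZero : ∀ n → + n ≈ 0ℤ → isZero p n ≡ true
  ≈-isZero n h = true-≡ᵇ (ℕD.n∣m⇒m%n≡0 n p (≈0→ℕ∣ h))

  conicCoeffs : ℕ → ℕ → T3
  conicCoeffs c k = (1ℤ , + k , + c * + k)

  conicℤ : ∀ c k x y z → + (x ℕ.* x ℕ.+ k ℕ.* y ℕ.* y ℕ.+ c ℕ.* k ℕ.* z ℕ.* z) ≈ Qf (conicCoeffs c k) (ι (x , y , z))
  conicℤ c k x y z = ≈-trans (≡→≈ e1) (≡→≈ (r (+ x) (+ y) (+ z) (+ k) (+ c)))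
    where
    e1 : + (x ℕ.* x ℕ.+ k ℕ.* y ℕ.* y ℕ.+ c ℕ.* k ℕ.* z ℕ.* z) ≡ + x * + x + + k * + y * + y + + c * + k * + z * + z
    e1 = trans (pos-+ (x ℕ.* x ℕ.+ k ℕ.* y ℕ.* y) (c ℕ.* k ℕ.* z ℕ.* z))
           (cong₂ _+_ (trans (pos-+ (x ℕ.* x) (k ℕ.* y ℕ.* y)) (cong₂ _+_ (pos-* x x)
                          (trans (pos-* (k ℕ.* y) y) (cong (_* + y) (pos-* k y)))))
                      (trans (pos-* (c ℕ.* k ℕ.* z) z) (cong (_* + z) (trans (pos-* (c ℕ.* k) z) (cong (_* + z) (pos-* c k))))))
    opaque
     unfolding _+_ _*_ -_
     r : ∀ x y z k c → x * x + k * y * y + c * k * z * z ≡ + 1 * (x * x) + k * (y * y) + (c * k) * (z * z)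
     r = ZS.solve-∀

  dotℤ : ∀ a b d x y z → + (a ℕ.* x ℕ.+ b ℕ.* y ℕ.+ d ℕ.* z) ≡ dot (ι (a , b , d)) (ι (x , y , z))
  dotℤ a b d x y z = trans (pos-+ (a ℕ.* x ℕ.+ b ℕ.* y) (d ℕ.* z))
     (cong₂ _+_ (trans (pos-+ (a ℕ.* x) (b ℕ.* y)) (cong₂ _+_ (pos-* a x) (pos-* b y))) (pos-* d z))

  onConic-≈ : ∀ c k X → onConic p c k X ≡ true → Qf (conicCoeffs c k) (ι X) ≈ 0ℤ
  onConic-≈ c k (x , y , z) h = ≈-trans (≈-sym (conicℤ c k x y z)) (isZero-≈ _ h)

  ≈-onConic : ∀ c k X → Qf (conicCoeffs c k) (ι X) ≈ 0ℤ → onConic p c k X ≡ true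
  ≈-onConic c k (x , y , z) h = ≈-isZero _ (≈-trans (conicℤ c k x y z) h)

  incident-≈ : ∀ X L → incident p X L ≡ true → dot (ι L) (ι X) ≈ 0ℤ
  incident-≈ (x , y , z) (a , b , d) h = Eq.subst (_≈ 0ℤ) (dotℤ a b d x y z) (isZero-≈ _ h)

  ≈-incident : ∀ X L → dot (ι L) (ι X) ≈ 0ℤ → incident p X L ≡ true
  ≈-incident (x , y , z) (a , b , d) h = ≈-isZero _ (Eq.subst (_≈ 0ℤ) (sym (dotℤ a b d x y z)) h)

  dual : T3 → T3
  dual e = (c2 e * c3 e , c1 e * c3 e , c1 e * c2 e)

  private
    opaque
     unfolding _+_ _*_ -_
     r-dotc : ∀ a b d x y z → a * x + b * y + d * z ≡ x * a + y * b + z * d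
     r-dotc = ZS.solve-∀
     r-Δd : ∀ e1 e2 e3 x y z →
        ((e1 * e3) * (e1 * e2)) * (x * x) + ((e2 * e3) * (e1 * e2)) * (y * y) + ((e2 * e3) * (e1 * e3)) * (z * z)
        ≡ (e1 * e2 * e3) * (e1 * (x * x) + e2 * (y * y) + e3 * (z * z))
     r-Δd = ZS.solve-∀
     r-ck : ∀ c k Q → - ((+ 1 * k * (c * k)) * Q) ≡ (- c * Q) * (k * k)
     r-ck = ZS.solve-∀

  dot-comm : ∀ u v → dot u v ≡ dot v u
  dot-comm (a , b , d) (x , y , z) = r-dotc a b d x y z

  Δdual : ∀ e v → Δ (dual e) v ≡ (c1 e * c2 e * c3 e) * Qf e v
  Δdual (e1 , e2 , e3) (x , y , z) = r-Δd e1 e2 e3 x y z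

  module Conic (c k : ℕ) (nc : ≉0 (+ c)) (nk : ≉0 (+ k)) where
    e : T3
    e = conicCoeffs c k
    n1 : ≉0 (c1 e)
    n1 = 1≉0
    n2 : ≉0 (c2 e)
    n2 = nk
    n3 : ≉0 (c3 e)
    n3 = mul≉0 nc nk

    module LineSection (L : Triple) (nL : Norm L) where
      S : LineBasis e (ι L)
      S = lineBasis e (ι L) n1 n2 n3 (Norm-NZ nL)
      open OnLine e (ι L) S
      g : Triple → Bool
      g P = onConic p c k P ∧ incident p P L
      g-sound : ∀ X → Norm X → g X ≡ true → OnBoth e (ι L) X
      g-sound X _ h = onConic-≈ c k X (proj₁ (∧-true h)) , incident-≈ X L (proj₂ (∧-true h))
      g-complete : ∀ X → Norm X → OnBoth e (ι L) X → g X ≡ true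
      g-complete X _ (a , b) = true-∧ (≈-onConic c k X a) (≈-incident X L b)
      open CountOnLine g g-sound g-complete public

    tangent⇒Δ≈0 : ∀ L → Norm L → isTangent p c k L ≡ true → Δ e (ι L) ≈ 0ℤ
    tangent⇒Δ≈0 L nL h = LineSection.count≡1⇒Δ≈0 L nL (≡ᵇ-true h)

    Δ≈0⇒tangent : ∀ L → Norm L → Δ e (ι L) ≈ 0ℤ → isTangent p c k L ≡ true
    Δ≈0⇒tangent L nL z = cong (_≡ᵇ 1) (LineSection.count-zero L nL z)

    -- the dual conic, whose points are the tangents of O_k
    e' : T3
    e' = dual e
    n1' : ≉0 (c1 e')
    n1' = mul≉0 n2 n3
    n2' : ≉0 (c2 e')
    n2' = mul≉0 n1 n3
    n3' : ≉0 (c3 e')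
    n3' = mul≉0 n1 n2

    -- the tangents of O_k through P: points of the dual conic on the line P
    module PencilAt (P : Triple) (nP : Norm P) where
      S : LineBasis e' (ι P)
      S = lineBasis e' (ι P) n1' n2' n3' (Norm-NZ nP)
      open OnLine e' (ι P) S
      g : Triple → Bool
      g L = incident p P L ∧ isTangent p c k L
      g-sound : ∀ X → Norm X → g X ≡ true → OnBoth e' (ι P) X
      g-sound X nX h = tangent⇒Δ≈0 X nX (proj₂ (∧-true h)) ,
                   Eq.subst (_≈ 0ℤ) (dot-comm (ι X) (ι P)) (incident-≈ P X (proj₁ (∧-true h)))
      g-complete : ∀ X → Norm X → OnBoth e' (ι P) X → g X ≡ true
      g-complete X nX (a , b) = true-∧ (≈-incident P X (Eq.subst (_≈ 0ℤ) (dot-comm (ι P) (ι X)) b)) (Δ≈0⇒tangent X nX a)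
      open CountOnLine g g-sound g-complete public

    -- for the dual conic e', -Δ(e', P) = (-c·Q_k(P))·k², so the two agree up to a nonzero square
    Δ'≈ : ∀ P → - Δ e' (ι P) ≈ (- (+ c) * Qf e (ι P)) * (+ k * + k)
    Δ'≈ P = ≈-trans (≡→≈ (cong -_ (Δdual e (ι P)))) (≡→≈ (r-ck (+ c) (+ k) (Qf e (ι P))))

    exterior⇒NSq : ∀ P → Norm P → isExterior p c k P ≡ true → NSq (- (+ c) * Qf e (ι P))
    exterior⇒NSq P nP h = NSq-unscale (NSq-resp (Δ'≈ P) (PencilAt.count≡2⇒NSq P nP (≡ᵇ-true h))) nk

    NSq⇒exterior : ∀ P → Norm P → NSq (- (+ c) * Qf e (ι P)) → isExterior p c k P ≡ true
    NSq⇒exterior P nP h with NSq-resp (≈-sym (Δ'≈ P)) (NSq-scale h nk)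
    ... | sq , -Δ≉0 = true-≡ᵇ (PencilAt.count-square P nP sq (λ Δ≈0 → -Δ≉0 (≈-trans (neg-cong Δ≈0) (≡→≈ neg0))))


module QuadraticResidues (q : ℕ) (pr : Prime (ℕ.suc q)) (p≥3 : 3 ≤ ℕ.suc q) (h : ℕ) (qh : q ≡ 2 ℕ.* h) where

  open import Defs
  open BooleanFacts
  open Counting
  open import Data.Nat as ℕ using (ℕ; zero; suc; _≡ᵇ_; _%_)
  import Data.Nat.Properties as ℕP
  import Data.Nat.Divisibility as ℕD
  open import Data.Nat.Primality using (Prime)
  open import Data.Integer as ℤ using (ℤ; +_)
  open IntegerOps
  import Data.Integer.Tactic.RingSolver as ZS
  open OddPrimeArithmetic
  open import Data.Bool using (Bool; true)
  import Data.Bool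
  open import Data.List using (List; []; _∷_; _++_; map; upTo; length)
  import Data.List.Properties as LP
  open import Data.List.Membership.Propositional using (_∈_)
  import Data.List.Membership.Propositional as ∈M
  import Data.List.Membership.Propositional.Properties as ∈
  open import Data.List.Membership.DecPropositional ℕP._≟_ using (_∈?_)
  open import Data.List.Relation.Unary.Any as Any using (here; there)
  open import Data.List.Relation.Unary.Unique.Propositional using (Unique)
  import Data.List.Relation.Unary.Unique.Propositional.Properties as UP
  open import Data.List.Relation.Unary.AllPairs using (_∷_; [])
  open import Data.List.Relation.Unary.All as All using (All)
  open import Data.Product using (Σ; _×_; _,_; proj₁; proj₂)
  open import Data.Sum using (_⊎_; inj₁; inj₂)
  open import Data.Empty using (⊥-elim)
  open import Relation.Nullary using (¬_; yes; no)
  open import Relation.Binary.PropositionalEquality as Eq using (_≡_; _≢_; refl; cong; cong₂; sym; trans)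
  open import Function using (_∘_)

  open PrimeField q pr p≥3 public

  h<p : h ℕ.< p
  h<p = ℕ.s≤s (Eq.subst (h ℕ.≤_) (sym qh) (ℕP.m≤m+n h (h ℕ.+ 0)))

  squareRep : ℕ → ℕ
  squareRep x = canon (+ x * + x)

  halfRange : List ℕ
  halfRange = map suc (upTo h)

  nonzeroSquares : List ℕ
  nonzeroSquares = map squareRep halfRange

  length-nonzeroSquares : length nonzeroSquares ≡ h
  length-nonzeroSquares = trans (LP.length-map squareRep halfRange) (trans (LP.length-map suc (upTo h)) (LP.length-upTo h))

  halfRange⁻ : ∀ {x} → x ∈ halfRange → (1 ℕ.≤ x) × (x ℕ.≤ h)
  halfRange⁻ m with ∈.∈-map⁻ suc m
  ... | y , ym , refl = ℕ.s≤s ℕ.z≤n , ∈.∈-upTo⁻ ym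

  halfRange⁺ : ∀ {x} → 1 ℕ.≤ x → x ℕ.≤ h → x ∈ halfRange
  halfRange⁺ {suc x} _ x≤h = ∈.∈-map⁺ suc (∈.∈-upTo⁺ x≤h)

  private
    pos+ : ∀ x y → + x + + y ≡ + (x ℕ.+ y)
    pos+ x y = sym (pos-+ x y)

  square-injective : ∀ {x y} → x ℕ.≤ h → y ℕ.≤ h → + x * + x ≈ + y * + y → x ≡ y
  square-injective {x} {y} xh yh e with sqrt-eq e
  ... | inj₁ e1 = residue-unique (ℕP.≤-<-trans xh h<p) (ℕP.≤-<-trans yh h<p) e1
  ... | inj₂ e2 = sum0 (x ℕ.+ y) refl dv
    where
    z : + (x ℕ.+ y) ≈ 0ℤ
    z = Eq.subst (_≈ 0ℤ) (pos+ x y) (≈-trans (+-congʳ (+ y) e2) (≡→≈ (r (+ y))))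
      where
      opaque
       unfolding _+_ _*_ -_
       r : ∀ a → - a + a ≡ + 0
       r = ZS.solve-∀
    dv : p ℕD.∣ (x ℕ.+ y)
    dv = ≈0→ℕ∣ z
    sum0 : ∀ n → n ≡ x ℕ.+ y → p ℕD.∣ n → x ≡ y
    sum0 zero e _ = trans (ℕP.m+n≡0⇒m≡0 x (sym e)) (sym (ℕP.m+n≡0⇒n≡0 x (sym e)))
    sum0 (suc n) e d = ⊥-elim (ℕP.<-irrefl refl (ℕP.<-≤-trans lt (ℕD.∣⇒≤ d)))
      where
      lt : suc n ℕ.< p
      lt = ℕ.s≤s (Eq.subst (ℕ._≤ q) (sym e) (Eq.subst (x ℕ.+ y ℕ.≤_) (sym qh) (ℕP.+-mono-≤ xh (ℕP.≤-trans yh (ℕP.m≤m+n h 0)))))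

  squareRep-injective : ∀ {x y} → x ℕ.≤ h → y ℕ.≤ h → squareRep x ≡ squareRep y → x ≡ y
  squareRep-injective {x} {y} xh yh e = square-injective xh yh (≈-trans (≈-sym (canon≈ (+ x * + x))) (≈-trans (≡→≈ (cong +_ e)) (canon≈ (+ y * + y))))

  -- x² for 1 ≤ x ≤ h are distinct, since x² = y² forces x = ±y
  nonzeroSquares-unique : Unique nonzeroSquares
  nonzeroSquares-unique = map-unique squareRep (UP.map⁺ ℕP.suc-injective (UP.upTo⁺ h))
                (λ m m' e → squareRep-injective (proj₂ (halfRange⁻ m)) (proj₂ (halfRange⁻ m')) e)

  nonzeroSquares⁻ : ∀ {s} → s ∈ nonzeroSquares → (s ℕ.< p) × NSq (+ s)
  nonzeroSquares⁻ m with ∈.∈-map⁻ squareRep m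
  ... | x , xm , refl = canon< (+ x * + x) , (+ x , ≈-sym (canon≈ (+ x * + x))) ,
         λ z → ℕ≉0 (proj₁ (halfRange⁻ xm)) (ℕP.≤-<-trans (proj₂ (halfRange⁻ xm)) h<p) (sq≈0 (≈-trans (≈-sym (canon≈ (+ x * + x))) z))

  root⇒nonzeroSquares : ∀ {s x} → 1 ℕ.≤ x → x ℕ.≤ h → s ℕ.< p → + x * + x ≈ + s → s ∈ nonzeroSquares
  root⇒nonzeroSquares {s} {x} x1 xh s<p e = Eq.subst (_∈ nonzeroSquares) (residue-unique (canon< _) s<p (≈-trans (canon≈ _) e)) (∈.∈-map⁺ squareRep (halfRange⁺ x1 xh))

  private
    opaque
     unfolding _+_ _*_ -_
     [-a][-a]≡aa : ∀ a → (- a) * (- a) ≡ a * a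
     [-a][-a]≡aa = ZS.solve-∀

  nonzeroSquares⁺ : ∀ {s} → s ℕ.< p → NSq (+ s) → s ∈ nonzeroSquares
  nonzeroSquares⁺ {s} s<p ((t , et) , ns) = go (canon t) refl
    where
    go : ∀ u → canon t ≡ u → s ∈ nonzeroSquares
    go zero e = ⊥-elim (ns (≈-trans (≈-sym et) (≈0-sq (≈-trans (≈-sym (canon≈ t)) (≡→≈ (cong +_ e))))))
      where
      ≈0-sq : t ≈ 0ℤ → t * t ≈ 0ℤ
      ≈0-sq z = ≈-trans (*-congʳ t z) (≡→≈ (*-zeroˡ t))
    go (suc u') e with suc u' ℕ.≤? h
    ... | yes uh = root⇒nonzeroSquares (ℕ.s≤s ℕ.z≤n) uh s<p (≈-trans (*-cong ut ut) et)
      where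
      ut : + suc u' ≈ t
      ut = Eq.subst (λ z → + z ≈ t) e (canon≈ t)
    ... | no nuh = root⇒nonzeroSquares x1 xh s<p (≈-trans (*-cong xneg xneg) (≈-trans (≡→≈ ([-a][-a]≡aa _)) (≈-trans (*-cong ut ut) et)))
      where
      u : ℕ
      u = suc u'
      ut : + u ≈ t
      ut = Eq.subst (λ z → + z ≈ t) e (canon≈ t)
      u<p : u ℕ.< p
      u<p = Eq.subst (ℕ._< p) e (canon< t)
      x : ℕ
      x = p ℕ.∸ u
      x1 : 1 ℕ.≤ x
      x1 = ℕP.m<n⇒0<n∸m u<p
      xh : x ℕ.≤ h
      xh = ℕP.≤-trans (ℕP.∸-monoʳ-≤ p (ℕP.≰⇒> nuh)) (ℕP.≤-reflexive pe)
        where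
        pe : p ℕ.∸ suc h ≡ h
        pe = trans (cong (ℕ._∸ h) qh) (trans (ℕP.m+n∸m≡n h (h ℕ.+ 0)) (ℕP.+-identityʳ h))
      xneg : + x ≈ - (+ u)
      xneg = neg-of (Eq.subst (_≈ 0ℤ) (trans (cong +_ (sym (ℕP.m∸n+n≡m (ℕP.<⇒≤ u<p)))) (pos-+ x u)) P≈0)

  private
    opaque
      unfolding _+_ _*_ -_
      [A-u]-[A-v]≡v-u : ∀ A u v → (A - u) - (A - v) ≡ v - u
      [A-u]-[A-v]≡v-u = ZS.solve-∀

  -- Pigeonhole: the h+1 residues x² and the h+1 residues A - B y² (0 ≤ x, y ≤ h) are
  -- p+1 values among p, and each family is duplicate-free, so x² = A - B y² is solvable.
  module _ (A B : ℤ) (B≉0 : ≉0 B) where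

    private
      lhs rhs : ℕ → ℕ
      lhs x = canon (+ x * + x)
      rhs y = canon (A - B * (+ y * + y))

      values : (ℕ → ℕ) → List ℕ
      values f = map f (upTo (suc h))

      unique-values : (f : ℕ → ℕ) → (∀ {x y} → f x ≡ f y → + x * + x ≈ + y * + y) → Unique (values f)
      unique-values f inj = map-unique f (UP.upTo⁺ (suc h)) λ m m' e → square-injective (≤h m) (≤h m') (inj e)
        where
        ≤h : ∀ {x} → x ∈ upTo (suc h) → x ℕ.≤ h
        ≤h m = ℕP.≤-pred (∈.∈-upTo⁻ m)

      rhs-inj : ∀ {x y} → rhs x ≡ rhs y → + x * + x ≈ + y * + y
      rhs-inj {x} {y} e = cancelˡ B≉0 (≈-sym (≈0→≈ (Eq.subst (_≈ 0ℤ)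
        ([A-u]-[A-v]≡v-u A (B * (+ x * + x)) (B * (+ y * + y))) (≈→≈0 (canon-injective e)))))

      length-values : length (values lhs ++ values rhs) ≡ suc p
      length-values = begin
        length (values lhs ++ values rhs)             ≡⟨ LP.length-++ (values lhs) ⟩
        length (values lhs) ℕ.+ length (values rhs)   ≡⟨ cong₂ ℕ._+_ (length-values-of lhs) (length-values-of rhs) ⟩
        suc h ℕ.+ suc h                               ≡⟨ ℕP.+-suc (suc h) h ⟩
        suc (suc (h ℕ.+ h))                           ≡⟨ cong (suc ∘ suc) (trans (sym (cong (h ℕ.+_) (ℕP.+-identityʳ h))) (sym qh)) ⟩
        suc p                                         ∎
        where
        open Eq.≡-Reasoning
        length-values-of : ∀ f → length (values f) ≡ suc h
        length-values-of f = trans (LP.length-map f (upTo (suc h))) (LP.length-upTo (suc h))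

      residues : ∀ {z} → z ∈ values lhs ++ values rhs → z ∈ upTo p
      residues m with ∈.∈-++⁻ (values lhs) m
      ... | inj₁ m1 with ∈.∈-map⁻ lhs m1
      ...   | _ , _ , refl = ∈.∈-upTo⁺ (canon< _)
      residues m | inj₂ m2 with ∈.∈-map⁻ rhs m2
      ...   | _ , _ , refl = ∈.∈-upTo⁺ (canon< _)

    x²≈A-By²-solvable : Σ ℕ λ x → Σ ℕ λ y → + x * + x ≈ A - B * (+ y * + y)
    x²≈A-By²-solvable with Any.any? (_∈? values rhs) (values lhs)
    ... | yes common with ∈M.find common
    ...   | s , s∈lhs , s∈rhs with ∈.∈-map⁻ lhs s∈lhs | ∈.∈-map⁻ rhs s∈rhs
    ...     | x , _ , s≡x² | y , _ , s≡rhs = x , y , canon-injective (trans (sym s≡x²) s≡rhs)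
    x²≈A-By²-solvable | no disjoint = ⊥-elim (ℕP.<-irrefl refl (begin-strict
        p                                  <⟨ ℕP.n<1+n p ⟩
        suc p                              ≡⟨ sym length-values ⟩
        length (values lhs ++ values rhs)  ≤⟨ unique-⊆⇒length-≤ lists-unique residues ⟩
        length (upTo p)                    ≡⟨ LP.length-upTo p ⟩
        p                                  ∎))
      where
      open ℕP.≤-Reasoning
      lists-unique : Unique (values lhs ++ values rhs)
      lists-unique = UP.++⁺ (unique-values lhs canon-injective) (unique-values rhs rhs-inj)
        (λ (m1 , m2) → disjoint (Any.map (λ { refl → m2 }) m1))

  invRep : ℕ → ℕ
  invRep s = canon (inv (+ s))

  private
    opaque
      unfolding _+_ _*_ -_
      [it]²≡i[t²i] : ∀ i t → (i * t) * (i * t) ≡ i * ((t * t) * i)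
      [it]²≡i[t²i] = ZS.solve-∀
      i[aa]≡[ia]a : ∀ i a → i * (a * a) ≡ (i * a) * a
      i[aa]≡[ia]a = ZS.solve-∀
      x+1-1≡x : ∀ x → x + + 1 + - (+ 1) ≡ x
      x+1-1≡x = ZS.solve-∀
      [-1][-1]≡1 : - (+ 1) * - (+ 1) ≡ + 1
      [-1][-1]≡1 = ZS.solve-∀
      neg-neg : ∀ d → - (- d) ≡ d
      neg-neg = ZS.solve-∀

  inv-NSq : ∀ {a} → NSq a → NSq (inv a)
  inv-NSq {a} ((t , et) , na) = (inv a * t , (begin
      (inv a * t) * (inv a * t)    ≈⟨ ≡→≈ ([it]²≡i[t²i] (inv a) t) ⟩
      inv a * ((t * t) * inv a)    ≈⟨ *-congˡ (inv a) (*-congʳ (inv a) et) ⟩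
      inv a * (a * inv a)          ≈⟨ *-congˡ (inv a) (inv-ok na) ⟩
      inv a * 1ℤ                   ≈⟨ ≡→≈ (*-identityʳ (inv a)) ⟩
      inv a                        ∎)) , inv≉0 na
    where open ≈R

  inv-self : ∀ {a} → a * a ≈ 1ℤ → inv a ≈ a
  inv-self {a} e = begin
      inv a                ≈⟨ ≡→≈ (sym (*-identityʳ (inv a))) ⟩
      inv a * 1ℤ           ≈⟨ *-congˡ (inv a) (≈-sym e) ⟩
      inv a * (a * a)      ≈⟨ ≡→≈ (i[aa]≡[ia]a (inv a) a) ⟩
      (inv a * a) * a      ≈⟨ *-congʳ a (≈-trans (≡→≈ (*-comm (inv a) a)) (inv-ok na)) ⟩
      1ℤ * a               ≈⟨ ≡→≈ (*-identityˡ a) ⟩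
      a                    ∎
    where
    open ≈R
    na : ≉0 a
    na z = 1≉0 (≈-trans (≈-sym e) (≈-trans (*-congʳ a z) (≡→≈ (*-zeroˡ a))))

  q≈-1 : + q ≈ - 1ℤ
  q≈-1 = begin
      + q                  ≈⟨ ≡→≈ (sym (x+1-1≡x (+ q))) ⟩
      + q + + 1 + - 1ℤ     ≈⟨ +-congʳ (- 1ℤ) (Eq.subst (_≈ 0ℤ) (trans (cong +_ (ℕP.+-comm 1 q)) (pos-+ q 1)) P≈0) ⟩
      0ℤ + - 1ℤ            ≈⟨ ≡→≈ (+-identityˡ (- 1ℤ)) ⟩
      - 1ℤ                 ∎
    where open ≈R

  q<p : q ℕ.< p
  q<p = ℕP.n<1+n q

  1<p : 1 ℕ.< p
  1<p = ℕP.≤-trans (ℕ.s≤s (ℕ.s≤s ℕ.z≤n)) p≥3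

  1≢q : 1 ≢ q
  1≢q e = ℕP.<-irrefl e (ℕP.≤-trans (ℕ.s≤s (ℕ.s≤s ℕ.z≤n)) (ℕP.≤-pred p≥3))

  h≥1 : 1 ℕ.≤ h
  h≥1 = ℕP.n≢0⇒n>0 λ h≡0 → 3≰1 (Eq.subst (λ z → 3 ℕ.≤ suc z) (trans qh (cong (2 ℕ.*_) h≡0)) p≥3)
    where
    3≰1 : ¬ (3 ℕ.≤ 1)
    3≰1 (ℕ.s≤s ())

  1∈nonzeroSquares : 1 ∈ nonzeroSquares
  1∈nonzeroSquares = root⇒nonzeroSquares (ℕ.s≤s ℕ.z≤n) h≥1 1<p (≡→≈ (*-identityʳ (+ 1)))

  -1-square⇒q∈ : Sq (- 1ℤ) → q ∈ nonzeroSquares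
  -1-square⇒q∈ s = nonzeroSquares⁺ q<p (Sq-resp (≈-sym q≈-1) s , ≉0-resp (≈-sym q≈-1) -1≉0)
    where
    -1≉0 : ≉0 (- 1ℤ)
    -1≉0 z = 1≉0 (≈-trans (≡→≈ (sym (neg-neg 1ℤ))) (≈-trans (neg-cong z) (≡→≈ neg0)))

  q∈⇒-1-square : q ∈ nonzeroSquares → Sq (- 1ℤ)
  q∈⇒-1-square m = Sq-resp q≈-1 (proj₁ (proj₂ (nonzeroSquares⁻ m)))

  invRep-involution : InvolutionOn invRep nonzeroSquares
  invRep-involution = record { closed = closed ; involutive = involutive }
    where
    closed : ∀ {s} → s ∈ nonzeroSquares → invRep s ∈ nonzeroSquares
    closed m = nonzeroSquares⁺ (canon< _) (NSq-resp (≈-sym (canon≈ _)) (inv-NSq (proj₂ (nonzeroSquares⁻ m))))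
    involutive : ∀ {s} → s ∈ nonzeroSquares → invRep (invRep s) ≡ s
    involutive m with nonzeroSquares⁻ m
    ... | s<p , (_ , s≉0) = residue-unique (canon< _) s<p
      (≈-trans (canon≈ _) (≈-trans (inv-cong (≉0-resp (≈-sym (canon≈ _)) (inv≉0 s≉0)) (canon≈ _)) (inv-inv s≉0)))

  -- its fixed points are the solutions of s² = 1, i.e. 1 and q
  invRep-fixed⇒1-or-q : ∀ {s} → s ∈ nonzeroSquares → isFixed invRep s ≡ true → (s ≡ 1) ⊎ (s ≡ q)
  invRep-fixed⇒1-or-q {s} m fixed with nonzeroSquares⁻ m
  ... | s<p , (_ , s≉0) with sqrt-eq {+ s} {1ℤ} s²≈1
    where
    s²≈1 : + s * + s ≈ 1ℤ * 1ℤ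
    s²≈1 = ≈-trans (*-congˡ (+ s) (≈-trans (≡→≈ (cong +_ (sym (≡ᵇ-true fixed)))) (canon≈ _)))
                   (≈-trans (inv-ok s≉0) (≡→≈ (sym (*-identityʳ 1ℤ))))
  ... | inj₁ s≈1 = inj₁ (residue-unique s<p 1<p s≈1)
  ... | inj₂ s≈-1 = inj₂ (residue-unique s<p q<p (≈-trans s≈-1 (≈-sym q≈-1)))

  invRep-1 : isFixed invRep 1 ≡ true
  invRep-1 = true-≡ᵇ (residue-unique (canon< _) 1<p (≈-trans (canon≈ _) (inv-self (≡→≈ (*-identityʳ (+ 1))))))

  invRep-q : isFixed invRep q ≡ true
  invRep-q = true-≡ᵇ (residue-unique (canon< _) q<p (≈-trans (canon≈ _) (inv-self (≈-trans (*-cong q≈-1 q≈-1) (≡→≈ [-1][-1]≡1)))))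

  count-fixed-with-q : q ∈ nonzeroSquares → count (isFixed invRep) nonzeroSquares ≡ 2
  count-fixed-with-q q∈ = count≡length (isFixed invRep) nonzeroSquares-unique ((1≢q All.∷ All.[]) ∷ (All.[] ∷ [])) sound complete
    where
    sound : ∀ z → z ∈ 1 ∷ q ∷ [] → z ∈ nonzeroSquares × isFixed invRep z ≡ true
    sound z (here refl) = 1∈nonzeroSquares , invRep-1
    sound z (there (here refl)) = q∈ , invRep-q
    complete : ∀ z → z ∈ nonzeroSquares → isFixed invRep z ≡ true → z ∈ 1 ∷ q ∷ []
    complete z m f with invRep-fixed⇒1-or-q m f
    ... | inj₁ refl = here refl
    ... | inj₂ refl = there (here refl)

  count-fixed-without-q : ¬ q ∈ nonzeroSquares → count (isFixed invRep) nonzeroSquares ≡ 1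
  count-fixed-without-q q∉ = count≡length (isFixed invRep) nonzeroSquares-unique (All.[] ∷ []) sound complete
    where
    sound : ∀ z → z ∈ 1 ∷ [] → z ∈ nonzeroSquares × isFixed invRep z ≡ true
    sound z (here refl) = 1∈nonzeroSquares , invRep-1
    complete : ∀ z → z ∈ nonzeroSquares → isFixed invRep z ≡ true → z ∈ 1 ∷ []
    complete z m f with invRep-fixed⇒1-or-q m f
    ... | inj₁ refl = here refl
    ... | inj₂ refl = ⊥-elim (q∉ m)

  nonzeroSquares-parity : Σ ℕ λ k → h ≡ count (isFixed invRep) nonzeroSquares ℕ.+ 2 ℕ.* k
  nonzeroSquares-parity with involution-parity invRep nonzeroSquares nonzeroSquares-unique invRep-involution
  ... | k , e = k , trans (sym length-nonzeroSquares) e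

  half-even⇒-1-square : (Σ ℕ λ m → h ≡ 2 ℕ.* m) → Sq (- 1ℤ)
  half-even⇒-1-square (m , hm) with q ∈? nonzeroSquares | nonzeroSquares-parity
  ... | yes q∈ | _ = q∈⇒-1-square q∈
  ... | no q∉ | k , hk = ⊥-elim (ℕP.even≢odd m k (begin
      2 ℕ.* m                                                 ≡⟨ sym hm ⟩
      h                                                       ≡⟨ hk ⟩
      count (isFixed invRep) nonzeroSquares ℕ.+ 2 ℕ.* k       ≡⟨ cong (ℕ._+ 2 ℕ.* k) (count-fixed-without-q q∉) ⟩
      suc (2 ℕ.* k)                                           ∎))
    where open Eq.≡-Reasoning

  half-odd⇒-1-nonsquare : (Σ ℕ λ m → h ≡ suc (2 ℕ.* m)) → ¬ Sq (- 1ℤ)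
  half-odd⇒-1-nonsquare (m , hm) s with nonzeroSquares-parity
  ... | k , hk = ℕP.even≢odd (suc k) m (begin
      2 ℕ.* suc k                                             ≡⟨ ℕP.*-suc 2 k ⟩
      2 ℕ.+ 2 ℕ.* k                                           ≡⟨ cong (ℕ._+ 2 ℕ.* k) (sym (count-fixed-with-q (-1-square⇒q∈ s))) ⟩
      count (isFixed invRep) nonzeroSquares ℕ.+ 2 ℕ.* k       ≡⟨ sym hk ⟩
      h                                                       ≡⟨ hm ⟩
      suc (2 ℕ.* m)                                           ∎)
    where open Eq.≡-Reasoning

  neg-c-nonsquare : ∀ c → 1 ℕ.≤ c → c ℕ.< p → p % 2 ≡ 1
    → (p % 4 ≡ 1 → ¬ IsSquare p c) → (p % 4 ≡ 3 → IsSquare p c) → ¬ Sq (- (+ c))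
  neg-c-nonsquare c c≥1 c<p odd nsq₁ sq₃ with odd-mod4 p odd
  ... | inj₁ p≡1 = neg-nonsquare₁ c (half-even⇒-1-square (1mod4⇒half-even q h qh p≡1)) (λ s → nsq₁ p≡1 (Sq⇒IsSquare c s))
  ... | inj₂ p≡3 = neg-nonsquare₃ c (half-odd⇒-1-nonsquare (3mod4⇒half-odd q h qh p≡3)) (IsSquare⇒Sq c (sq₃ p≡3)) (ℕ≉0 c≥1 c<p)


-- For P = (x,y,z) on O_β write w = y² + c z²; then x² = -βw and
-- -c·Q_α(P) = cβ(α-β)·(x/β)², with x ≠ 0.  So O_α ◇ O_β iff cβ(α-β) is a nonzero square,
-- and α = β + s/(cβ) runs bijectively over the admissible α as s runs over the nonzero squares.
module DiamondCount (q : ℕ) (pr : Prime (ℕ.suc q)) (p≥3 : 3 ≤ ℕ.suc q) (h : ℕ) (qh : q ≡ 2 ℕ.* h) where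

  open import Defs
  open Counting
  open import Data.Nat as ℕ using (ℕ; suc)
  import Data.Nat.Properties as ℕP
  open import Data.Integer as ℤ using (ℤ; +_)
  open IntegerOps
  import Data.Integer.Tactic.RingSolver as ZS
  open import Data.Bool using (Bool; true; false; if_then_else_)
  open import Data.List using (List; map; length)
  import Data.List.Properties as LP
  open import Data.List.Membership.Propositional using (_∈_)
  import Data.List.Membership.Propositional.Properties as ∈
  open import Data.List.Relation.Unary.Unique.Propositional using (Unique)
  import Data.List.Relation.Unary.Unique.Propositional.Properties as UP
  open import Data.Product using (Σ; _×_; _,_; proj₁; proj₂)
  open import Data.Empty using (⊥-elim)
  open import Relation.Nullary using (¬_; yes; no)
  open import Relation.Binary.PropositionalEquality as Eq using (_≡_; _≢_; refl; cong; sym; trans)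

  open Tangency q pr p≥3
  open QuadraticResidues q pr p≥3 h qh
    using (x²≈A-By²-solvable; neg-c-nonsquare; nonzeroSquares; nonzeroSquares-unique; length-nonzeroSquares; nonzeroSquares⁻; nonzeroSquares⁺)

  private
    opaque
      unfolding _+_ _*_ -_
      Q≡x²+kw : ∀ x y z c k → + 1 * (x * x) + k * (y * y) + (c * k) * (z * z) ≡ x * x + k * (y * y + c * (z * z))
      Q≡x²+kw = ZS.solve-∀
      Q-on-xy1 : ∀ x y c b → + 1 * (x * x) + b * (y * y) + (c * b) * (+ 1 * + 1) ≡ x * x - (- (c * b) - b * (y * y))
      Q-on-xy1 = ZS.solve-∀
      -c[-βw+αw] : ∀ c a b w → - c * (- (b * w) + a * w) ≡ - c * ((a - b) * w)
      -c[-βw+αw] = ZS.solve-∀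
      regroup-x² : ∀ c a b x i → ((c * b) * (a - b)) * ((x * i) * (x * i)) ≡ ((c * (a - b)) * (x * x)) * ((b * i) * i)
      regroup-x² = ZS.solve-∀
      regroup-w : ∀ c a b w i → ((c * (a - b)) * (- (b * w))) * ((b * i) * i) ≡ (- c * ((a - b) * w)) * ((b * i) * (b * i))
      regroup-w = ZS.solve-∀
      X[1*1]≡X : ∀ X → X * (+ 1 * + 1) ≡ X
      X[1*1]≡X = ZS.solve-∀
      b+u-[b+v]≡u-v : ∀ b u v → b + u - (b + v) ≡ u - v
      b+u-[b+v]≡u-v = ZS.solve-∀
      s[wk]≡[sw]k : ∀ s w k → s * (w * k) ≡ (s * w) * k
      s[wk]≡[sw]k = ZS.solve-∀
      [-b][cb]i² : ∀ c b i → ((- b) * (c * b)) * (i * i) ≡ - c * ((b * i) * (b * i))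
      [-b][cb]i² = ZS.solve-∀
      k[b+sw-b]≡s[wk] : ∀ k b s w → k * (b + s * w - b) ≡ s * (w * k)
      k[b+sw-b]≡s[wk] = ZS.solve-∀
      b+[k[a-b]]w≡b+[a-b][wk] : ∀ b k a w → b + (k * (a - b)) * w ≡ b + (a - b) * (w * k)
      b+[k[a-b]]w≡b+[a-b][wk] = ZS.solve-∀
      b+[a-b]1≡a : ∀ b a → b + (a - b) * + 1 ≡ a
      b+[a-b]1≡a = ZS.solve-∀

  module _ (c : ℕ) (c≥1 : 1 ℕ.≤ c) (c<p : c ℕ.< p) (odd : p ℕ.% 2 ≡ 1)
           (nsq₁ : p ℕ.% 4 ≡ 1 → ¬ IsSquare p c) (sq₃ : p ℕ.% 4 ≡ 3 → IsSquare p c)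
           (β : ℕ) (β≥1 : 1 ℕ.≤ β) (β<p : β ℕ.< p) where

    negc : ¬ Sq (- (+ c))
    negc = neg-c-nonsquare c c≥1 c<p odd nsq₁ sq₃

    c≉0 : ≉0 (+ c)
    c≉0 = ℕ≉0 c≥1 c<p
    β≉0 : ≉0 (+ β)
    β≉0 = ℕ≉0 β≥1 β<p

    -- O_β has a point (x : y : 1) with x² = -cβ - βy².
    -- (opaque, so that type checking never computes this point)
    opaque
      pointOnOβ : Σ Triple λ X → Norm X × (onConic p c β X ≡ true)
      pointOnOβ with x²≈A-By²-solvable (- (+ c * + β)) (+ β) β≉0
      ... | x , y , x²≈ = X , norm-Norm v v≉0 , ≈-onConic c β X QX≈0
        where
        v : T3
        v = (+ x , + y , 1ℤ)
        v≉0 : NZ v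
        v≉0 (_ , _ , 1≈0) = 1≉0 1≈0
        X : Triple
        X = norm v v≉0
        Qv≈0 : Qf (conicCoeffs c β) v ≈ 0ℤ
        Qv≈0 = ≈-trans (≡→≈ (Q-on-xy1 (+ x) (+ y) (+ c) (+ β))) (≈→≈0 x²≈)
        QX≈0 : Qf (conicCoeffs c β) (ι X) ≈ 0ℤ
        QX≈0 with norm-∼ v v≉0
        ... | t , _ , X≈tv = ≈-trans (Qf-cong (conicCoeffs c β) X≈tv)
          (≈-trans (≡→≈ (Qf-scale (conicCoeffs c β) t v)) (≈-trans (*-congˡ (t * t) Qv≈0) (≡→≈ (*-zeroʳ (t * t)))))

    onOβ⇒x² : ∀ x y z → onConic p c β (x , y , z) ≡ true → + x * + x ≈ - (+ β * (+ y * + y + + c * (+ z * + z)))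
    onOβ⇒x² x y z on = neg-of (≈-trans (≡→≈ (sym (Q≡x²+kw (+ x) (+ y) (+ z) (+ c) (+ β)))) (onConic-≈ c β (x , y , z) on))

    -- Points of O_β have x ≠ 0: otherwise y² = -cz², which forces y = z = 0 as -c is a nonsquare.
    onOβ⇒x≉0 : ∀ X → Norm X → onConic p c β X ≡ true → ≉0 (c1 (ι X))
    onOβ⇒x≉0 (x , y , z) nX on x≈0 = Norm-NZ nX (x≈0 , y≈0 , z≈0)
      where
      w≈0 : + y * + y + + c * (+ z * + z) ≈ 0ℤ
      w≈0 = cancel-≈0 β≉0 (neg≈0 (≈-trans (≈-sym (onOβ⇒x² x y z on)) (≈-trans (*-cong x≈0 x≈0) (≡→≈ (*-zeroʳ 0ℤ)))))
      y²≈-cz² : + y * + y ≈ - (+ c) * (+ z * + z)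
      y²≈-cz² = ≈-trans (neg-of w≈0) (≡→≈ (neg-distribˡ-* (+ c) (+ z * + z)))
      z≈0 : + z ≈ 0ℤ
      z≈0 with ≈0? (+ z)
      ... | yes z≈0 = z≈0
      ... | no z≉0 = ⊥-elim (negc (sq-ratio y²≈-cz² z≉0))
      y≈0 : + y ≈ 0ℤ
      y≈0 = sq≈0 (≈-trans y²≈-cz² (≈-trans (*-congˡ (- (+ c)) (≈-trans (*-cong z≈0 z≈0) (≡→≈ (*-zeroʳ 0ℤ)))) (≡→≈ (*-zeroʳ (- (+ c))))))

    criterion : ℕ → ℤ
    criterion α = (+ c * + β) * (+ α - + β)

    Qα-on-Oβ : ∀ X → onConic p c β X ≡ true → ∀ α →
      - (+ c) * Qf (conicCoeffs c α) (ι X) ≈ criterion α * ((c1 (ι X) * inv (+ β)) * (c1 (ι X) * inv (+ β)))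
    Qα-on-Oβ (x₀ , y₀ , z₀) on α = begin
      - (+ c) * Qf (conicCoeffs c α) (x , y , z)                  ≈⟨ *-congˡ (- (+ c)) (≡→≈ (Q≡x²+kw x y z (+ c) (+ α))) ⟩
      - (+ c) * (x * x + + α * w)                        ≈⟨ *-congˡ (- (+ c)) (+-congʳ (+ α * w) x²≈) ⟩
      - (+ c) * (- (+ β * w) + + α * w)                  ≈⟨ ≡→≈ (-c[-βw+αw] (+ c) (+ α) (+ β) w) ⟩
      - (+ c) * ((+ α - + β) * w)                        ≈⟨ ≈-sym (≈-trans (*-congˡ _ (*-cong (inv-ok β≉0) (inv-ok β≉0))) (≡→≈ (X[1*1]≡X _))) ⟩
      (- (+ c) * ((+ α - + β) * w)) * ((+ β * i) * (+ β * i)) ≈⟨ ≡→≈ (sym (regroup-w (+ c) (+ α) (+ β) w i)) ⟩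
      ((+ c * (+ α - + β)) * (- (+ β * w))) * ((+ β * i) * i) ≈⟨ *-congʳ ((+ β * i) * i) (*-congˡ (+ c * (+ α - + β)) (≈-sym x²≈)) ⟩
      ((+ c * (+ α - + β)) * (x * x)) * ((+ β * i) * i)  ≈⟨ ≡→≈ (sym (regroup-x² (+ c) (+ α) (+ β) x i)) ⟩
      criterion α * ((x * i) * (x * i))                  ∎
      where
      open ≈R
      x y z w i : ℤ
      x = + x₀
      y = + y₀
      z = + z₀
      w = y * y + + c * (z * z)
      i = inv (+ β)
      x²≈ : x * x ≈ - (+ β * w)
      x²≈ = onOβ⇒x² x₀ y₀ z₀ on

    private
      if-true : ∀ {b : Bool} {x} → b ≡ true → (if b then x else true) ≡ x
      if-true refl = refl

      exteriorIfOnOβ : ℕ → Triple → Bool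
      exteriorIfOnOβ α P = if onConic p c β P then isExterior p c α P else true

      x/β≉0 : ∀ X → Norm X → onConic p c β X ≡ true → ≉0 (c1 (ι X) * inv (+ β))
      x/β≉0 X nX on = mul≉0 (onOβ⇒x≉0 X nX on) (inv≉0 β≉0)

    criterion⇒diamond : ∀ α → 1 ℕ.≤ α → α ℕ.< p → NSq (criterion α) → diamond p c α β ≡ true
    criterion⇒diamond α α≥1 α<p crit = all-complete (exteriorIfOnOβ α) (PG2 p) λ P m → exterior-if-on P (PG2-Norm m)
      where
      open Conic c α c≉0 (ℕ≉0 α≥1 α<p) using (NSq⇒exterior)
      exterior-if-on : ∀ P → Norm P → exteriorIfOnOβ α P ≡ true
      exterior-if-on P nP with onConic p c β P in on
      ... | false = refl
      ... | true = NSq⇒exterior P nP (NSq-resp (≈-sym (Qα-on-Oβ P on α)) (NSq-scale crit (x/β≉0 P nP on)))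

    exterior⇒criterion : ∀ α → 1 ℕ.≤ α → α ℕ.< p → ∀ P → Norm P → onConic p c β P ≡ true
      → isExterior p c α P ≡ true → NSq (criterion α)
    exterior⇒criterion α α≥1 α<p P nP on ext =
      NSq-unscale (NSq-resp (Qα-on-Oβ P on α) (exterior⇒NSq P nP ext)) (x/β≉0 P nP on)
      where open Conic c α c≉0 (ℕ≉0 α≥1 α<p) using (exterior⇒NSq)

    -- Conversely, O_α ◇ O_β makes cβ(α-β) a nonzero square: test it at a point of O_β.
    diamond⇒criterion : ∀ α → 1 ℕ.≤ α → α ℕ.< p → diamond p c α β ≡ true → NSq (criterion α)
    diamond⇒criterion α α≥1 α<p d = exterior⇒criterion α α≥1 α<p X nX onX
      (trans (sym (if-true {onConic p c β X} {isExterior p c α X} onX)) (all-sound {f = exteriorIfOnOβ α} {xs = PG2 p} d X (Norm-PG2 nX)))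
      where
      X : Triple
      X = proj₁ pointOnOβ
      nX : Norm X
      nX = proj₁ (proj₂ pointOnOβ)
      onX : onConic p c β X ≡ true
      onX = proj₂ (proj₂ pointOnOβ)

    private
      cβ : ℤ
      cβ = + c * + β
      cβ≉0 : ≉0 cβ
      cβ≉0 = mul≉0 c≉0 β≉0
      w : ℤ
      w = inv cβ
      w≉0 : ≉0 w
      w≉0 = inv≉0 cβ≉0
      wcβ≈1 : w * cβ ≈ 1ℤ
      wcβ≈1 = ≈-trans (≡→≈ (*-comm w cβ)) (inv-ok cβ≉0)

    -- the index α = β + s/(cβ) attached to a residue s, so that cβ(α-β) = s
    αOf : ℕ → ℕ
    αOf s = canon (+ β + + s * w)

    criterion-αOf : ∀ s → criterion (αOf s) ≈ + s
    criterion-αOf s = begin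
      cβ * (+ αOf s - + β)          ≈⟨ *-congˡ cβ (+-congʳ (- (+ β)) (canon≈ _)) ⟩
      cβ * (+ β + + s * w - + β)    ≈⟨ ≡→≈ (k[b+sw-b]≡s[wk] cβ (+ β) (+ s) w) ⟩
      + s * (w * cβ)                ≈⟨ *-congˡ (+ s) wcβ≈1 ⟩
      + s * 1ℤ                      ≈⟨ ≡→≈ (*-identityʳ (+ s)) ⟩
      + s                           ∎
      where open ≈R

    αOf-criterion : ∀ α → α ℕ.< p → αOf (canon (criterion α)) ≡ α
    αOf-criterion α α<p = residue-unique (canon< _) α<p (begin
      + αOf (canon (criterion α))              ≈⟨ canon≈ _ ⟩
      + β + + canon (criterion α) * w          ≈⟨ +-congˡ (+ β) (*-congʳ w (canon≈ _)) ⟩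
      + β + criterion α * w                    ≈⟨ ≡→≈ (b+[k[a-b]]w≡b+[a-b][wk] (+ β) cβ (+ α) w) ⟩
      + β + (+ α - + β) * (w * cβ)             ≈⟨ +-congˡ (+ β) (*-congˡ (+ α - + β) wcβ≈1) ⟩
      + β + (+ α - + β) * 1ℤ                   ≈⟨ ≡→≈ (b+[a-b]1≡a (+ β) (+ α)) ⟩
      + α                                      ∎)
      where open ≈R

    αOf-injective : ∀ {s s'} → s ∈ nonzeroSquares → s' ∈ nonzeroSquares → αOf s ≡ αOf s' → s ≡ s'
    αOf-injective {s} {s'} m m' e = residue-unique (proj₁ (nonzeroSquares⁻ m)) (proj₁ (nonzeroSquares⁻ m'))
      (cancelˡ w≉0 (≈-trans (≡→≈ (*-comm w (+ s)))
        (≈-trans (≈0→≈ (Eq.subst (_≈ 0ℤ) (b+u-[b+v]≡u-v (+ β) (+ s * w) (+ s' * w)) (≈→≈0 (canon-injective e))))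
                 (≡→≈ (*-comm (+ s') w)))))

    -- α = 0 would need s = -cβ², making -c a square.
    αOf≢0 : ∀ {s} → s ∈ nonzeroSquares → αOf s ≢ 0
    αOf≢0 {s} m αOf≡0 = negc (Sq-resp -βcβ/β²≈-c (Sq-* (Sq-resp s≈-βcβ (proj₁ (proj₂ (nonzeroSquares⁻ m)))) (inv (+ β) , ≈-refl)))
      where
      β+sw≈0 : + β + + s * w ≈ 0ℤ
      β+sw≈0 = ≈-trans (≈-sym (canon≈ _)) (≡→≈ (cong +_ αOf≡0))
      s≈-βcβ : + s ≈ (- (+ β)) * cβ
      s≈-βcβ = begin
        + s                  ≈⟨ ≡→≈ (sym (*-identityʳ (+ s))) ⟩
        + s * 1ℤ             ≈⟨ *-congˡ (+ s) (≈-sym wcβ≈1) ⟩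
        + s * (w * cβ)       ≈⟨ ≡→≈ (s[wk]≡[sw]k (+ s) w cβ) ⟩
        (+ s * w) * cβ       ≈⟨ *-congʳ cβ (neg-ofʳ β+sw≈0) ⟩
        (- (+ β)) * cβ       ∎
        where open ≈R
      -βcβ/β²≈-c : ((- (+ β)) * cβ) * (inv (+ β) * inv (+ β)) ≈ - (+ c)
      -βcβ/β²≈-c = ≈-trans (≡→≈ ([-b][cb]i² (+ c) (+ β) (inv (+ β))))
        (≈-trans (*-congˡ (- (+ c)) (*-cong (inv-ok β≉0) (inv-ok β≉0))) (≡→≈ (X[1*1]≡X (- (+ c)))))

    private
      admissible : List ℕ
      admissible = map αOf nonzeroSquares

      ∈indices : ∀ {n} → 1 ℕ.≤ n → n ℕ.< p → n ∈ indices p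
      ∈indices {suc n} _ lt = ∈.∈-map⁺ suc (∈.∈-upTo⁺ (ℕP.≤-pred lt))

      αOf≥1 : ∀ {s} → s ∈ nonzeroSquares → 1 ℕ.≤ αOf s
      αOf≥1 m = ℕP.n≢0⇒n>0 (αOf≢0 m)

      sound : ∀ α → α ∈ admissible → α ∈ indices p × diamond p c α β ≡ true
      sound α m with ∈.∈-map⁻ αOf m
      ... | s , s∈ , refl = ∈indices (αOf≥1 s∈) (canon< _) ,
        criterion⇒diamond (αOf s) (αOf≥1 s∈) (canon< _) (NSq-resp (≈-sym (criterion-αOf s)) (proj₂ (nonzeroSquares⁻ s∈)))

      complete : ∀ α → α ∈ indices p → diamond p c α β ≡ true → α ∈ admissible
      complete α m d with ∈.∈-map⁻ suc m
      ... | a , a∈ , refl = Eq.subst (_∈ admissible) (αOf-criterion (suc a) α<p) (∈.∈-map⁺ αOf s∈)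
        where
        α<p : suc a ℕ.< p
        α<p = ℕ.s≤s (∈.∈-upTo⁻ a∈)
        s∈ : canon (criterion (suc a)) ∈ nonzeroSquares
        s∈ = nonzeroSquares⁺ (canon< _) (NSq-resp (≈-sym (canon≈ _)) (diamond⇒criterion (suc a) (ℕ.s≤s ℕ.z≤n) α<p d))

    finalCount : count (λ α → diamond p c α β) (indices p) ≡ h
    finalCount = begin
      count (λ α → diamond p c α β) (indices p)  ≡⟨ count≡length (λ α → diamond p c α β) (UP.map⁺ ℕP.suc-injective (UP.upTo⁺ q))
                                                      (map-unique αOf nonzeroSquares-unique αOf-injective) sound complete ⟩
      length admissible                ≡⟨ LP.length-map αOf nonzeroSquares ⟩
      length nonzeroSquares            ≡⟨ length-nonzeroSquares ⟩
      h                                          ∎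
      where open Eq.≡-Reasoning


mainTheorem8 : (p c : ℕ) → Prime p → p % 2 ≡ 1
    → 1 ≤ c → c < p
    → (p % 4 ≡ 1 → ¬ IsSquare p c)
    → (p % 4 ≡ 3 → IsSquare p c)
    → (β : ℕ) → 1 ≤ β → β < p
    → count (λ α → diamond p c α β) (indices p) ≡ (p ∸ 1) / 2
mainTheorem8 ℕ.zero c pr _ _ _ _ _ _ _ _ = ⊥-elim (ℕ.NonZero.nonZero (prime⇒nonZero pr))
mainTheorem8 (ℕ.suc q) c pr odd c≥1 c<p nsq₁ sq₃ β β≥1 β<p = Eq.trans
  (DiamondCount.finalCount q pr p≥3 h qh c c≥1 c<p odd nsq₁ sq₃ β β≥1 β<p)
  (Eq.sym (half-pred q h qh))
  where
  open OddPrimeArithmetic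
  p≥3 : 3 ≤ ℕ.suc q
  p≥3 = oddPrime≥3 q pr odd
  h : ℕ
  h = ℕ.suc q / 2
  qh : q ≡ 2 ℕ.* h
  qh = odd⇒even-pred q odd
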